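{- If $\mathcal{A}$ is a set of $6$ generic and linearly general points in $\mathbf{P}^2$, then $I_{\mathcal{A}}$ is generated by products of linear forms.
   Context: $k$ is an infinite field, $S=k[x,y,z]$ is the homogeneous coordinate ring of $\mathbf{P}^2$, and for a finite set $\mathcal{A}$ of points, $I_{\mathcal{A}}\subseteq S$ is the homogeneous ideal of all polynomials vanishing on $\mathcal{A}$. A set of points is linearly general if no three are collinear; a set of $r$ points is generic if $\dim_k(S/I_{\mathcal{A}})_t=\min\{r,\binom{t+2}{2}\}$ for all $t$. -}

module Defs where

open import Level using (Level; _⊔_) renaming (suc to lsuc)
open import Algebra.Bundles using (CommutativeRing)
open import Data.Nat as ℕ using (ℕ; zero; suc; _≟_)
open import Data.Nat.Combinatorics using (_C_)
open import Data.Fin using (Fin) renaming (zero to fzero; suc to fsuc)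
open import Data.Product using (Σ; _×_; _,_; ∃)
open import Data.List using (List; []; _∷_; map; concatMap; foldr)
open import Data.List.Relation.Unary.All using (All)
open import Relation.Nullary using (¬_; yes; no)
open import Relation.Binary.PropositionalEquality using (_≡_)

record Field (c ℓ : Level) : Set (lsuc (c ⊔ ℓ)) where
  field
    commutativeRing : CommutativeRing c ℓ
  open CommutativeRing commutativeRing public
  field
    0≉1 : ¬ (0# ≈ 1#)
    inverse : ∀ x → ¬ (x ≈ 0#) → Σ Carrier λ y → (x * y) ≈ 1#

module _ {c ℓ : Level} (F : Field c ℓ) where
  open Field F

  Infinite : Set (c ⊔ ℓ)
  Infinite = Σ (ℕ → Carrier) λ f → ∀ m n → f m ≈ f n → m ≡ n

  -- polynomials in S = k[x,y,z] as finite lists of terms (coefficient, exponents of x,y,z);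
  -- two polynomials are equal when all their coefficients agree.
  Exp : Set
  Exp = ℕ × ℕ × ℕ

  Poly : Set c
  Poly = List (Carrier × Exp)

  sameExp : Exp → Exp → Set
  sameExp (a , b , d) (a' , b' , d') = (a ≡ a') × (b ≡ b') × (d ≡ d')

  coeff : Poly → Exp → Carrier
  coeff [] e = 0#
  coeff ((r , (a , b , d)) ∷ p) (a' , b' , d') with a ≟ a' | b ≟ b' | d ≟ d'
  ... | yes _ | yes _ | yes _ = r + coeff p (a' , b' , d')
  ... | _ | _ | _ = coeff p (a' , b' , d')

  _≈P_ : Poly → Poly → Set ℓ
  p ≈P q = ∀ e → coeff p e ≈ coeff q e

  0P : Poly
  0P = []

  1P : Poly
  1P = (1# , (0 , 0 , 0)) ∷ []

  _+P_ : Poly → Poly → Poly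
  [] +P q = q
  (t ∷ p) +P q = t ∷ (p +P q)

  addExp : Exp → Exp → Exp
  addExp (a , b , d) (a' , b' , d') = (a ℕ.+ a' , b ℕ.+ b' , d ℕ.+ d')

  _*P_ : Poly → Poly → Poly
  p *P q = concatMap (λ { (r , e) → map (λ { (s , e') → (r * s , addExp e e') }) q }) p

  scaleP : Carrier → Poly → Poly
  scaleP r p = map (λ { (s , e) → (r * s , e) }) p

  negP : Poly → Poly
  negP = scaleP (- 1#)

  deg : Exp → ℕ
  deg (a , b , d) = a ℕ.+ b ℕ.+ d

  Homogeneous : ℕ → Poly → Set ℓ
  Homogeneous t p = ∀ e → ¬ (deg e ≡ t) → coeff p e ≈ 0#

  homComp : ℕ → Poly → Poly
  homComp t [] = []
  homComp t ((r , e) ∷ p) with deg e ≟ t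
  ... | yes _ = (r , e) ∷ homComp t p
  ... | no _ = homComp t p

  _^_ : Carrier → ℕ → Carrier
  r ^ zero = 1#
  r ^ suc n = r * (r ^ n)

  -- representatives of points of P²: nonzero triples
  Point : Set (c ⊔ ℓ)
  Point = Σ (Carrier × Carrier × Carrier) λ { (x , y , z) → ¬ ((x ≈ 0#) × (y ≈ 0#) × (z ≈ 0#)) }

  eval : Poly → Carrier × Carrier × Carrier → Carrier
  eval [] v = 0#
  eval ((r , (a , b , d)) ∷ p) (x , y , z) = r * ((x ^ a) * ((y ^ b) * (z ^ d))) + eval p (x , y , z)

  VanishesAt : Poly → Point → Set ℓ
  VanishesAt p (v , _) = ∀ t → eval (homComp t p) v ≈ 0#

  SamePoint : Point → Point → Set (c ⊔ ℓ)
  SamePoint ((x , y , z) , _) ((x' , y' , z') , _) =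
    Σ Carrier λ λ' → ¬ (λ' ≈ 0#) × (x' ≈ λ' * x) × (y' ≈ λ' * y) × (z' ≈ λ' * z)

  LinearForm : Set (c ⊔ ℓ)
  LinearForm = Σ (Carrier × Carrier × Carrier) λ { (a , b , d) → ¬ ((a ≈ 0#) × (b ≈ 0#) × (d ≈ 0#)) }

  linPoly : LinearForm → Poly
  linPoly ((a , b , d) , _) = (a , (1 , 0 , 0)) ∷ (b , (0 , 1 , 0)) ∷ (d , (0 , 0 , 1)) ∷ []

  Collinear : Point → Point → Point → Set (c ⊔ ℓ)
  Collinear P Q R = Σ LinearForm λ L →
    VanishesAt (linPoly L) P × VanishesAt (linPoly L) Q × VanishesAt (linPoly L) R

  module Points {n : ℕ} (A : Fin n → Point) where

    Distinct : Set (c ⊔ ℓ)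
    Distinct = ∀ i j → ¬ (i ≡ j) → ¬ SamePoint (A i) (A j)

    LinearlyGeneral : Set (c ⊔ ℓ)
    LinearlyGeneral = ∀ i j l → ¬ (i ≡ j) → ¬ (j ≡ l) → ¬ (i ≡ l) → ¬ Collinear (A i) (A j) (A l)

    InI : Poly → Set ℓ
    InI p = ∀ i → VanishesAt p (A i)

    linComb : {r : ℕ} → (Fin r → Carrier) → (Fin r → Poly) → Poly
    linComb {zero} cs fs = 0P
    linComb {suc r} cs fs = scaleP (cs fzero) (fs fzero) +P linComb (λ i → cs (fsuc i)) (λ i → fs (fsuc i))

    -- dim_k (S/I_A)_t = r : there are r degree-t forms whose classes form a basis of S_t / (I_A)_t
    QuotDim : ℕ → ℕ → Set (c ⊔ ℓ)
    QuotDim t r = Σ (Fin r → Poly) λ fs →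
        (∀ i → Homogeneous t (fs i))
      × (∀ (cs : Fin r → Carrier) → InI (linComb cs fs) → ∀ i → cs i ≈ 0#)
      × (∀ g → Homogeneous t g → Σ (Fin r → Carrier) λ cs → InI (g +P negP (linComb cs fs)))

    Generic : Set (c ⊔ ℓ)
    Generic = ∀ t → QuotDim t (ℕ._⊓_ n ((t ℕ.+ 2) C 2))

    ProdLin : Poly → Set (c ⊔ ℓ)
    ProdLin g = Σ (List LinearForm) λ Ls → g ≈P foldr (λ L h → linPoly L *P h) 1P Ls

    GeneratedByProdLin : Set (c ⊔ ℓ)
    GeneratedByProdLin = ∀ f → InI f →
      Σ (List (Poly × Poly)) λ hs →
        All (λ { (h , g) → ProdLin g × InI g }) hs
        × (f ≈P foldr (λ { (h , g) acc → (h *P g) +P acc }) 0P hs)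

{-# OPTIONS --safe #-}

-- Let J be the ideal generated by the products of lines through pairs of the six points that
-- together pass through all of them; these products lie in I_A. For each point f fix such a
-- product Q f of three lines through the other five points, so that Q f vanishes at every point
-- except f. Cramer's rule writes any linear form in terms of the sides of a triangle of the
-- points, and a line through a point in terms of two other lines through it; a finite derivation
-- with these two moves shows that every cubic lies in J + span {Q f}. Multiplying by linear forms
-- propagates this to every degree ≥ 3, where an element of I_A then lies in J because evaluating
-- at the points kills the coefficients of the Q's. In degrees ≤ 2 only 0 vanishes at the points:
-- in degrees 0 and 1 by linear generality, and in degree 2 because a conic through the six points
-- would contradict genericity, dim (S/I_A)₂ = 6.

module Submission where

open import Level using (Level; _⊔_)
open import Defs
open import Algebra.Bundles using (CommutativeRing; RawRing)
open import Data.Bool using (Bool; true; false; if_then_else_)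
open import Data.Empty using (⊥; ⊥-elim)
open import Data.Fin as Fin using (Fin; punchIn) renaming (zero to fzero; suc to fsuc)
open import Data.Fin.Patterns
import Data.Fin.Properties as Fin
open import Data.List as List using (List; []; _∷_; _++_; replicate; foldr)
import Data.List.Properties as List
open import Data.List.Relation.Unary.All as All using (All; []; _∷_)
import Data.List.Relation.Unary.All.Properties as All
open import Data.List.Relation.Unary.Any as Any using (Any; here; there)
import Data.List.Relation.Unary.Any.Properties as Any
open import Data.Maybe using (Maybe; just; nothing)
open import Data.Nat as ℕ using (ℕ; zero; suc; _∸_)
import Data.Nat.Properties as ℕ
open import Data.Product using (Σ; _×_; _,_; proj₁; proj₂)
open import Data.Product.Properties using (≡-dec)
open import Data.Sum using (_⊎_; inj₁; inj₂)
open import Data.Vec.Functional using (insertAt)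
open import Data.Vec.Functional.Properties using (insertAt-lookup; insertAt-punchIn)
open import Function using (_∘_; case_of_)
open import Relation.Binary.Definitions using (DecidableEquality)
open import Relation.Binary.PropositionalEquality as ≡ using (_≡_; _≢_)
import Relation.Binary.Reasoning.Setoid as ≈-Reasoning
open import Relation.Nullary using (¬_; yes; no; Dec)
open import Relation.Nullary.Decidable using (True; toWitness; ¬?; _⊎-dec_; _×-dec_; _→-dec_; ¬¬-excluded-middle)
open import Relation.Nullary.Negation using (¬¬-map; negated-stable; contradiction)

-- The ring solver of the standard library needs a coefficient ring with decidable
-- equality mapping into the given ring; for an arbitrary commutative ring we use ℤ.
module IntegerCoefficients {c ℓ : Level} (R : CommutativeRing c ℓ) where

  open CommutativeRing R hiding (zero)
  open import Algebra.Solver.Ring.AlmostCommutativeRing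
  open import Algebra.Properties.Semiring.Mult.TCOptimised semiring using (1+×; ×-homo-+; ×1-homo-*) renaming (_×_ to _×′_)
  open import Algebra.Properties.Ring ring using (-‿distribˡ-*; -‿distribʳ-*; -‿+-comm; -‿involutive; -0#≈0#)
  open import Algebra.Properties.CommutativeSemigroup +-commutativeSemigroup using (interchange)
  open import Relation.Binary.Reasoning.Setoid setoid

  private
    -- m - n is represented by (m , n), kept with one component zero so that
    -- equal integers are identical pairs
    ℤ′ : Set
    ℤ′ = ℕ × ℕ

    diff : ℕ → ℕ → ℤ′
    diff m n = (m ∸ n , n ∸ m)

    ℤ′-rawRing : RawRing _ _
    ℤ′-rawRing = record
      { Carrier = ℤ′ ; _≈_ = _≡_
      ; _+_ = λ { (a , b) (c , d) → diff (a ℕ.+ c) (b ℕ.+ d) }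
      ; _*_ = λ { (a , b) (c , d) → diff (a ℕ.* c ℕ.+ b ℕ.* d) (a ℕ.* d ℕ.+ b ℕ.* c) }
      ; -_ = λ { (a , b) → (b , a) }
      ; 0# = (0 , 0) ; 1# = (1 , 0) }

    ⟦_⟧ : ℤ′ → Carrier
    ⟦ (m , zero) ⟧ = m ×′ 1#
    ⟦ (zero , suc n) ⟧ = - (suc n ×′ 1#)
    ⟦ (suc m , suc n) ⟧ = ⟦ (m , n) ⟧

    +-minus : ∀ x y u v → (x + y) - (u + v) ≈ (x - u) + (y - v)
    +-minus x y u v = trans (+-congˡ (sym (-‿+-comm u v))) (interchange x y (- u) (- v))

    *-minus : ∀ x y u v → (x * u + y * v) - (x * v + y * u) ≈ (x - y) * (u - v)
    *-minus x y u v = sym (begin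
      (x - y) * (u - v)                           ≈⟨ distribʳ (u - v) x (- y) ⟩
      x * (u - v) + - y * (u - v)                 ≈⟨ +-cong (distribˡ x u (- v)) (distribˡ (- y) u (- v)) ⟩
      (x * u + x * - v) + (- y * u + - y * - v)   ≈⟨ +-cong (+-congˡ (sym (-‿distribʳ-* x v))) (+-cong (sym (-‿distribˡ-* y u)) -y*-v) ⟩
      (x * u - x * v) + (- (y * u) + y * v)       ≈⟨ +-congˡ (+-comm _ _) ⟩
      (x * u - x * v) + (y * v - y * u)           ≈⟨ sym (+-minus (x * u) (y * v) (x * v) (y * u)) ⟩
      (x * u + y * v) - (x * v + y * u)           ∎)
      where
      -y*-v : - y * - v ≈ y * v
      -y*-v = trans (sym (-‿distribˡ-* y (- v))) (trans (-‿cong (sym (-‿distribʳ-* y v))) (-‿involutive (y * v)))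

    1+-minus : ∀ m n → suc m ×′ 1# - suc n ×′ 1# ≈ m ×′ 1# - n ×′ 1#
    1+-minus m n = begin
      suc m ×′ 1# - suc n ×′ 1#         ≈⟨ +-cong (1+× m 1#) (-‿cong (1+× n 1#)) ⟩
      (1# + m ×′ 1#) - (1# + n ×′ 1#)   ≈⟨ +-minus 1# (m ×′ 1#) 1# (n ×′ 1#) ⟩
      (1# - 1#) + (m ×′ 1# - n ×′ 1#)   ≈⟨ +-congʳ (-‿inverseʳ 1#) ⟩
      0# + (m ×′ 1# - n ×′ 1#)          ≈⟨ +-identityˡ _ ⟩
      m ×′ 1# - n ×′ 1#                 ∎

    ⟦⟧≈- : ∀ m n → ⟦ (m , n) ⟧ ≈ m ×′ 1# - n ×′ 1#
    ⟦⟧≈- m       zero    = sym (trans (+-congˡ -0#≈0#) (+-identityʳ _))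
    ⟦⟧≈- zero    (suc n) = sym (+-identityˡ _)
    ⟦⟧≈- (suc m) (suc n) = trans (⟦⟧≈- m n) (sym (1+-minus m n))

    ⟦diff⟧ : ∀ m n → ⟦ diff m n ⟧ ≈ m ×′ 1# - n ×′ 1#
    ⟦diff⟧ zero    zero    = ⟦⟧≈- zero zero
    ⟦diff⟧ (suc m) zero    = ⟦⟧≈- (suc m) zero
    ⟦diff⟧ zero    (suc n) = ⟦⟧≈- zero (suc n)
    ⟦diff⟧ (suc m) (suc n) = trans (⟦diff⟧ m n) (sym (1+-minus m n))

    ⟦⟧-homo-+ : ∀ m n m′ n′ → ⟦ diff (m ℕ.+ m′) (n ℕ.+ n′) ⟧ ≈ ⟦ (m , n) ⟧ + ⟦ (m′ , n′) ⟧
    ⟦⟧-homo-+ m n m′ n′ = begin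
      ⟦ diff (m ℕ.+ m′) (n ℕ.+ n′) ⟧                ≈⟨ ⟦diff⟧ (m ℕ.+ m′) (n ℕ.+ n′) ⟩
      (m ℕ.+ m′) ×′ 1# - (n ℕ.+ n′) ×′ 1#           ≈⟨ +-cong (×-homo-+ 1# m m′) (-‿cong (×-homo-+ 1# n n′)) ⟩
      (m ×′ 1# + m′ ×′ 1#) - (n ×′ 1# + n′ ×′ 1#)   ≈⟨ +-minus _ _ _ _ ⟩
      (m ×′ 1# - n ×′ 1#) + (m′ ×′ 1# - n′ ×′ 1#)   ≈⟨ sym (+-cong (⟦⟧≈- m n) (⟦⟧≈- m′ n′)) ⟩
      ⟦ (m , n) ⟧ + ⟦ (m′ , n′) ⟧                   ∎

    ⟦⟧-homo-* : ∀ m n m′ n′ →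
      ⟦ diff (m ℕ.* m′ ℕ.+ n ℕ.* n′) (m ℕ.* n′ ℕ.+ n ℕ.* m′) ⟧ ≈ ⟦ (m , n) ⟧ * ⟦ (m′ , n′) ⟧
    ⟦⟧-homo-* m n m′ n′ = begin
      ⟦ diff (m ℕ.* m′ ℕ.+ n ℕ.* n′) (m ℕ.* n′ ℕ.+ n ℕ.* m′) ⟧
        ≈⟨ ⟦diff⟧ (m ℕ.* m′ ℕ.+ n ℕ.* n′) (m ℕ.* n′ ℕ.+ n ℕ.* m′) ⟩
      (m ℕ.* m′ ℕ.+ n ℕ.* n′) ×′ 1# - (m ℕ.* n′ ℕ.+ n ℕ.* m′) ×′ 1#
        ≈⟨ +-cong (×-homo-+ 1# (m ℕ.* m′) (n ℕ.* n′)) (-‿cong (×-homo-+ 1# (m ℕ.* n′) (n ℕ.* m′))) ⟩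
      ((m ℕ.* m′) ×′ 1# + (n ℕ.* n′) ×′ 1#) - ((m ℕ.* n′) ×′ 1# + (n ℕ.* m′) ×′ 1#)
        ≈⟨ +-cong (+-cong (×1-homo-* m m′) (×1-homo-* n n′)) (-‿cong (+-cong (×1-homo-* m n′) (×1-homo-* n m′))) ⟩
      (M * M′ + N * N′) - (M * N′ + N * M′)
        ≈⟨ *-minus M N M′ N′ ⟩
      (M - N) * (M′ - N′)
        ≈⟨ sym (*-cong (⟦⟧≈- m n) (⟦⟧≈- m′ n′)) ⟩
      ⟦ (m , n) ⟧ * ⟦ (m′ , n′) ⟧ ∎
      where
      M = m ×′ 1# ; N = n ×′ 1# ; M′ = m′ ×′ 1# ; N′ = n′ ×′ 1#

    ⟦⟧-homo-- : ∀ m n → ⟦ (n , m) ⟧ ≈ - ⟦ (m , n) ⟧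
    ⟦⟧-homo-- m n = begin
      ⟦ (n , m) ⟧                  ≈⟨ ⟦⟧≈- n m ⟩
      n ×′ 1# - m ×′ 1#            ≈⟨ +-comm _ _ ⟩
      - (m ×′ 1#) + n ×′ 1#        ≈⟨ +-congˡ (sym (-‿involutive _)) ⟩
      - (m ×′ 1#) - - (n ×′ 1#)    ≈⟨ -‿+-comm _ _ ⟩
      - (m ×′ 1# - n ×′ 1#)        ≈⟨ -‿cong (sym (⟦⟧≈- m n)) ⟩
      - ⟦ (m , n) ⟧                ∎

    ℤ′-morphism : ℤ′-rawRing -Raw-AlmostCommutative⟶ fromCommutativeRing R
    ℤ′-morphism = record
      { ⟦_⟧ = ⟦_⟧
      ; +-homo = λ { (m , n) (m′ , n′) → ⟦⟧-homo-+ m n m′ n′ }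
      ; *-homo = λ { (m , n) (m′ , n′) → ⟦⟧-homo-* m n m′ n′ }
      ; -‿homo = λ { (m , n) → ⟦⟧-homo-- m n }
      ; 0-homo = refl
      ; 1-homo = refl }

    ℤ′-≟ : ∀ i j → Maybe (⟦ i ⟧ ≈ ⟦ j ⟧)
    ℤ′-≟ i j with ≡-dec ℕ._≟_ ℕ._≟_ i j
    ... | yes ≡.refl = just refl
    ... | no _       = nothing

  open import Algebra.Solver.Ring ℤ′-rawRing (fromCommutativeRing R) ℤ′-morphism ℤ′-≟ public
    using (solve; _:=_; _:+_; _:*_; _:-_; :-_; con)

module FieldProperties {c ℓ : Level} (F : Field c ℓ) where

  open Field F

  _⁻¹[_] : ∀ x → ¬ x ≈ 0# → Carrier
  x ⁻¹[ x≉0 ] = proj₁ (inverse x x≉0)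

  x*x⁻¹≈1 : ∀ x (x≉0 : ¬ x ≈ 0#) → x * x ⁻¹[ x≉0 ] ≈ 1#
  x*x⁻¹≈1 x x≉0 = proj₂ (inverse x x≉0)

  x*y≈0⇒y≈0 : ∀ {x y} → ¬ x ≈ 0# → x * y ≈ 0# → y ≈ 0#
  x*y≈0⇒y≈0 {x} {y} x≉0 xy≈0 = begin
    y                          ≈⟨ sym (*-identityˡ y) ⟩
    1# * y                     ≈⟨ *-congʳ (sym (trans (*-comm _ _) (x*x⁻¹≈1 x x≉0))) ⟩
    x ⁻¹[ x≉0 ] * x * y        ≈⟨ *-assoc _ _ _ ⟩
    x ⁻¹[ x≉0 ] * (x * y)      ≈⟨ *-congˡ xy≈0 ⟩
    x ⁻¹[ x≉0 ] * 0#           ≈⟨ zeroʳ _ ⟩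
    0#                         ∎
    where open ≈-Reasoning setoid

  *-nonzero : ∀ {x y} → ¬ x ≈ 0# → ¬ y ≈ 0# → ¬ x * y ≈ 0#
  *-nonzero x≉0 y≉0 xy≈0 = y≉0 (x*y≈0⇒y≈0 x≉0 xy≈0)

module Vectors {c ℓ : Level} (F : Field c ℓ) where

  open Field F
  open IntegerCoefficients commutativeRing using (solve; _:=_; _:+_; _:*_; _:-_; :-_; con)

  K³ : Set c
  K³ = Carrier × Carrier × Carrier

  infixl 7 _·_
  _·_ : K³ → K³ → Carrier
  (a₁ , a₂ , a₃) · (b₁ , b₂ , b₃) = a₁ * b₁ + a₂ * b₂ + a₃ * b₃

  cross : K³ → K³ → K³
  cross (a₁ , a₂ , a₃) (b₁ , b₂ , b₃) = (a₂ * b₃ - a₃ * b₂ , a₃ * b₁ - a₁ * b₃ , a₁ * b₂ - a₂ * b₁)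

  det : K³ → K³ → K³ → Carrier
  det a b d = cross a b · d

  cross-·ˡ : ∀ a b → cross a b · a ≈ 0#
  cross-·ˡ (a₁ , a₂ , a₃) (b₁ , b₂ , b₃) =
    solve 6 (λ a₁ a₂ a₃ b₁ b₂ b₃ →
      (a₂ :* b₃ :- a₃ :* b₂) :* a₁ :+ (a₃ :* b₁ :- a₁ :* b₃) :* a₂ :+ (a₁ :* b₂ :- a₂ :* b₁) :* a₃ := con (0 , 0))
      refl a₁ a₂ a₃ b₁ b₂ b₃

  cross-·ʳ : ∀ a b → cross a b · b ≈ 0#
  cross-·ʳ (a₁ , a₂ , a₃) (b₁ , b₂ , b₃) =
    solve 6 (λ a₁ a₂ a₃ b₁ b₂ b₃ →
      (a₂ :* b₃ :- a₃ :* b₂) :* b₁ :+ (a₃ :* b₁ :- a₁ :* b₃) :* b₂ :+ (a₁ :* b₂ :- a₂ :* b₁) :* b₃ := con (0 , 0))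
      refl a₁ a₂ a₃ b₁ b₂ b₃

  infixl 6 _⊕_
  infixr 7 _⊙_
  infix 4 _≈ᵥ_

  _⊕_ : K³ → K³ → K³
  (a₁ , a₂ , a₃) ⊕ (b₁ , b₂ , b₃) = (a₁ + b₁ , a₂ + b₂ , a₃ + b₃)

  _⊙_ : Carrier → K³ → K³
  r ⊙ (b₁ , b₂ , b₃) = (r * b₁ , r * b₂ , r * b₃)

  _≈ᵥ_ : K³ → K³ → Set ℓ
  (a₁ , a₂ , a₃) ≈ᵥ (b₁ , b₂ , b₃) = (a₁ ≈ b₁) × (a₂ ≈ b₂) × (a₃ ≈ b₃)

  cramer : ∀ a b d w → det a b d ⊙ w ≈ᵥ (w · a) ⊙ cross b d ⊕ (w · b) ⊙ cross d a ⊕ (w · d) ⊙ cross a b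
  cramer (a₁ , a₂ , a₃) (b₁ , b₂ , b₃) (d₁ , d₂ , d₃) (w₁ , w₂ , w₃) =
      solve 12 (λ a₁ a₂ a₃ b₁ b₂ b₃ d₁ d₂ d₃ w₁ w₂ w₃ →
        ((a₂ :* b₃ :- a₃ :* b₂) :* d₁ :+ (a₃ :* b₁ :- a₁ :* b₃) :* d₂ :+ (a₁ :* b₂ :- a₂ :* b₁) :* d₃) :* w₁
        := (w₁ :* a₁ :+ w₂ :* a₂ :+ w₃ :* a₃) :* (b₂ :* d₃ :- b₃ :* d₂) :+ (w₁ :* b₁ :+ w₂ :* b₂ :+ w₃ :* b₃) :* (d₂ :* a₃ :- d₃ :* a₂)
           :+ (w₁ :* d₁ :+ w₂ :* d₂ :+ w₃ :* d₃) :* (a₂ :* b₃ :- a₃ :* b₂))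
        refl a₁ a₂ a₃ b₁ b₂ b₃ d₁ d₂ d₃ w₁ w₂ w₃
    , solve 12 (λ a₁ a₂ a₃ b₁ b₂ b₃ d₁ d₂ d₃ w₁ w₂ w₃ →
        ((a₂ :* b₃ :- a₃ :* b₂) :* d₁ :+ (a₃ :* b₁ :- a₁ :* b₃) :* d₂ :+ (a₁ :* b₂ :- a₂ :* b₁) :* d₃) :* w₂
        := (w₁ :* a₁ :+ w₂ :* a₂ :+ w₃ :* a₃) :* (b₃ :* d₁ :- b₁ :* d₃) :+ (w₁ :* b₁ :+ w₂ :* b₂ :+ w₃ :* b₃) :* (d₃ :* a₁ :- d₁ :* a₃)
           :+ (w₁ :* d₁ :+ w₂ :* d₂ :+ w₃ :* d₃) :* (a₃ :* b₁ :- a₁ :* b₃))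
        refl a₁ a₂ a₃ b₁ b₂ b₃ d₁ d₂ d₃ w₁ w₂ w₃
    , solve 12 (λ a₁ a₂ a₃ b₁ b₂ b₃ d₁ d₂ d₃ w₁ w₂ w₃ →
        ((a₂ :* b₃ :- a₃ :* b₂) :* d₁ :+ (a₃ :* b₁ :- a₁ :* b₃) :* d₂ :+ (a₁ :* b₂ :- a₂ :* b₁) :* d₃) :* w₃
        := (w₁ :* a₁ :+ w₂ :* a₂ :+ w₃ :* a₃) :* (b₁ :* d₂ :- b₂ :* d₁) :+ (w₁ :* b₁ :+ w₂ :* b₂ :+ w₃ :* b₃) :* (d₁ :* a₂ :- d₂ :* a₁)
           :+ (w₁ :* d₁ :+ w₂ :* d₂ :+ w₃ :* d₃) :* (a₁ :* b₂ :- a₂ :* b₁))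
        refl a₁ a₂ a₃ b₁ b₂ b₃ d₁ d₂ d₃ w₁ w₂ w₃

  cross-antisym : ∀ a b → cross b a ≈ᵥ (- 1#) ⊙ cross a b
  cross-antisym (a₁ , a₂ , a₃) (b₁ , b₂ , b₃) =
      solve 6 (λ a₁ a₂ a₃ b₁ b₂ b₃ → b₂ :* a₃ :- b₃ :* a₂ := (:- con (1 , 0)) :* (a₂ :* b₃ :- a₃ :* b₂)) refl a₁ a₂ a₃ b₁ b₂ b₃
    , solve 6 (λ a₁ a₂ a₃ b₁ b₂ b₃ → b₃ :* a₁ :- b₁ :* a₃ := (:- con (1 , 0)) :* (a₃ :* b₁ :- a₁ :* b₃)) refl a₁ a₂ a₃ b₁ b₂ b₃
    , solve 6 (λ a₁ a₂ a₃ b₁ b₂ b₃ → b₁ :* a₂ :- b₂ :* a₁ := (:- con (1 , 0)) :* (a₁ :* b₂ :- a₂ :* b₁)) refl a₁ a₂ a₃ b₁ b₂ b₃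

  ·-comm : ∀ a b → a · b ≈ b · a
  ·-comm (a₁ , a₂ , a₃) (b₁ , b₂ , b₃) = +-cong (+-cong (*-comm a₁ b₁) (*-comm a₂ b₂)) (*-comm a₃ b₃)

  ≈ᵥ-trans : ∀ {a b d} → a ≈ᵥ b → b ≈ᵥ d → a ≈ᵥ d
  ≈ᵥ-trans (a₁≈ , a₂≈ , a₃≈) (b₁≈ , b₂≈ , b₃≈) = trans a₁≈ b₁≈ , trans a₂≈ b₂≈ , trans a₃≈ b₃≈

  ⊙⊕-≈0 : ∀ {r s t a b d} → r ≈ 0# → s ≈ 0# → t ≈ 0# → r ⊙ a ⊕ s ⊙ b ⊕ t ⊙ d ≈ᵥ (0# , 0# , 0#)
  ⊙⊕-≈0 {r} {s} {t} {a₁ , a₂ , a₃} {b₁ , b₂ , b₃} {d₁ , d₂ , d₃} r≈0 s≈0 t≈0 =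
    vanish a₁ b₁ d₁ , vanish a₂ b₂ d₂ , vanish a₃ b₃ d₃
    where
    vanish : ∀ x y z → r * x + s * y + t * z ≈ 0#
    vanish x y z = trans (+-cong (+-cong (trans (*-congʳ r≈0) (zeroˡ x)) (trans (*-congʳ s≈0) (zeroˡ y))) (trans (*-congʳ t≈0) (zeroˡ z)))
                         (trans (+-identityʳ _) (+-identityʳ 0#))

  ·-⊕ : ∀ u a b → u · (a ⊕ b) ≈ u · a + u · b
  ·-⊕ (u₁ , u₂ , u₃) (a₁ , a₂ , a₃) (b₁ , b₂ , b₃) =
    solve 9 (λ u₁ u₂ u₃ a₁ a₂ a₃ b₁ b₂ b₃ → u₁ :* (a₁ :+ b₁) :+ u₂ :* (a₂ :+ b₂) :+ u₃ :* (a₃ :+ b₃)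
                                          := (u₁ :* a₁ :+ u₂ :* a₂ :+ u₃ :* a₃) :+ (u₁ :* b₁ :+ u₂ :* b₂ :+ u₃ :* b₃))
      refl u₁ u₂ u₃ a₁ a₂ a₃ b₁ b₂ b₃

  -- a three-term Plücker relation
  det-exchange : ∀ p₀ p₁ p₂ p₃ p₄ →
    det p₁ p₂ p₃ * det p₂ p₀ p₄ - det p₂ p₀ p₃ * det p₁ p₂ p₄ ≈ det p₀ p₁ p₂ * det p₂ p₃ p₄
  det-exchange (a₁ , a₂ , a₃) (b₁ , b₂ , b₃) (c₁ , c₂ , c₃) (d₁ , d₂ , d₃) (g₁ , g₂ , g₃) =
    solve 15 (λ a₁ a₂ a₃ b₁ b₂ b₃ c₁ c₂ c₃ d₁ d₂ d₃ g₁ g₂ g₃ →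
      ((b₂ :* c₃ :- b₃ :* c₂) :* d₁ :+ (b₃ :* c₁ :- b₁ :* c₃) :* d₂ :+ (b₁ :* c₂ :- b₂ :* c₁) :* d₃)
        :* ((c₂ :* a₃ :- c₃ :* a₂) :* g₁ :+ (c₃ :* a₁ :- c₁ :* a₃) :* g₂ :+ (c₁ :* a₂ :- c₂ :* a₁) :* g₃)
      :- ((c₂ :* a₃ :- c₃ :* a₂) :* d₁ :+ (c₃ :* a₁ :- c₁ :* a₃) :* d₂ :+ (c₁ :* a₂ :- c₂ :* a₁) :* d₃)
        :* ((b₂ :* c₃ :- b₃ :* c₂) :* g₁ :+ (b₃ :* c₁ :- b₁ :* c₃) :* g₂ :+ (b₁ :* c₂ :- b₂ :* c₁) :* g₃)
      := ((a₂ :* b₃ :- a₃ :* b₂) :* c₁ :+ (a₃ :* b₁ :- a₁ :* b₃) :* c₂ :+ (a₁ :* b₂ :- a₂ :* b₁) :* c₃)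
        :* ((c₂ :* d₃ :- c₃ :* d₂) :* g₁ :+ (c₃ :* d₁ :- c₁ :* d₃) :* g₂ :+ (c₁ :* d₂ :- c₂ :* d₁) :* g₃))
      refl a₁ a₂ a₃ b₁ b₂ b₃ c₁ c₂ c₃ d₁ d₂ d₃ g₁ g₂ g₃

  ·-congˡ : ∀ u {a b} → a ≈ᵥ b → u · a ≈ u · b
  ·-congˡ (u₁ , u₂ , u₃) (a₁≈ , a₂≈ , a₃≈) = +-cong (+-cong (*-congˡ a₁≈) (*-congˡ a₂≈)) (*-congˡ a₃≈)

module Polynomials {c ℓ : Level} (F : Field c ℓ) where

  open Field F
  open import Relation.Binary.Reasoning.Setoid setoid

  private
    _+ₑ_ : Exp F → Exp F → Exp F
    _+ₑ_ = addExp F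

  infixl 6 _+ₚ_
  infixl 7 _*ₚ_
  infix 4 _≈ₚ_

  _+ₚ_ _*ₚ_ : Poly F → Poly F → Poly F
  _+ₚ_ = _+P_ F
  _*ₚ_ = _*P_ F

  -- A record rather than the bare function type _≈P_, so that both
  -- polynomials can be inferred from a proof.
  record _≈ₚ_ (p q : Poly F) : Set ℓ where
    constructor coeffwise
    field at : _≈P_ F p q
  open _≈ₚ_ public

  _≟ₑ_ : DecidableEquality (Exp F)
  _≟ₑ_ = ≡-dec ℕ._≟_ (≡-dec ℕ._≟_ ℕ._≟_)

  δ : Exp F → Exp F → Carrier → Carrier
  δ e e′ r with e ≟ₑ e′
  ... | yes _ = r
  ... | no _  = 0#

  δ-≡ : ∀ e e′ r → e ≡ e′ → δ e e′ r ≈ r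
  δ-≡ e e′ r eq with e ≟ₑ e′
  ... | yes _ = refl
  ... | no ne = ⊥-elim (ne eq)

  δ-≢ : ∀ e e′ r → ¬ e ≡ e′ → δ e e′ r ≈ 0#
  δ-≢ e e′ r ne with e ≟ₑ e′
  ... | yes eq = ⊥-elim (ne eq)
  ... | no _   = refl

  δ-0 : ∀ e e′ → δ e e′ 0# ≈ 0#
  δ-0 e e′ with e ≟ₑ e′
  ... | yes _ = refl
  ... | no _  = refl

  δ-cong : ∀ e e′ {r s} → r ≈ s → δ e e′ r ≈ δ e e′ s
  δ-cong e e′ r≈s with e ≟ₑ e′
  ... | yes _ = r≈s
  ... | no _  = refl

  δ-+ : ∀ e e′ r s → δ e e′ (r + s) ≈ δ e e′ r + δ e e′ s
  δ-+ e e′ r s with e ≟ₑ e′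
  ... | yes _ = refl
  ... | no _  = sym (+-identityˡ 0#)

  δ-* : ∀ e e′ r s → δ e e′ (r * s) ≈ r * δ e e′ s
  δ-* e e′ r s with e ≟ₑ e′
  ... | yes _ = refl
  ... | no _  = sym (zeroʳ r)

  coeff-∷ : ∀ r e p e′ → coeff F ((r , e) ∷ p) e′ ≈ δ e e′ r + coeff F p e′
  coeff-∷ r e@(a , b , d) p e′@(a′ , b′ , d′) with e ≟ₑ e′
  coeff-∷ r (a , b , d) p (a , b , d) | yes ≡.refl with a ℕ.≟ a | b ℕ.≟ b | d ℕ.≟ d
  ... | yes _ | yes _ | yes _ = refl
  ... | no ne | _     | _     = ⊥-elim (ne ≡.refl)
  ... | yes _ | no ne | _     = ⊥-elim (ne ≡.refl)
  ... | yes _ | yes _ | no ne = ⊥-elim (ne ≡.refl)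
  coeff-∷ r (a , b , d) p (a′ , b′ , d′) | no e≢e′ with a ℕ.≟ a′ | b ℕ.≟ b′ | d ℕ.≟ d′
  ... | yes ≡.refl | yes ≡.refl | yes ≡.refl = ⊥-elim (e≢e′ ≡.refl)
  ... | no _  | _     | _     = sym (+-identityˡ _)
  ... | yes _ | no _  | _     = sym (+-identityˡ _)
  ... | yes _ | yes _ | no _  = sym (+-identityˡ _)

  coeff-+ : ∀ p q e → coeff F (p +ₚ q) e ≈ coeff F p e + coeff F q e
  coeff-+ [] q e = sym (+-identityˡ _)
  coeff-+ ((r , e′) ∷ p) q e = begin
    coeff F ((r , e′) ∷ (p +ₚ q)) e               ≈⟨ coeff-∷ r e′ (p +ₚ q) e ⟩
    δ e′ e r + coeff F (p +ₚ q) e              ≈⟨ +-congˡ (coeff-+ p q e) ⟩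
    δ e′ e r + (coeff F p e + coeff F q e)      ≈⟨ sym (+-assoc _ _ _) ⟩
    (δ e′ e r + coeff F p e) + coeff F q e      ≈⟨ +-congʳ (sym (coeff-∷ r e′ p e)) ⟩
    coeff F ((r , e′) ∷ p) e + coeff F q e        ∎

  coeff-scale : ∀ r p e → coeff F (scaleP F r p) e ≈ r * coeff F p e
  coeff-scale r [] e = sym (zeroʳ r)
  coeff-scale r ((s , e′) ∷ p) e = begin
    coeff F ((r * s , e′) ∷ scaleP F r p) e       ≈⟨ coeff-∷ (r * s) e′ (scaleP F r p) e ⟩
    δ e′ e (r * s) + coeff F (scaleP F r p) e   ≈⟨ +-cong (δ-* e′ e r s) (coeff-scale r p e) ⟩
    r * δ e′ e s + r * coeff F p e              ≈⟨ sym (distribˡ r _ _) ⟩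
    r * (δ e′ e s + coeff F p e)                ≈⟨ *-congˡ (sym (coeff-∷ s e′ p e)) ⟩
    r * coeff F ((s , e′) ∷ p) e                  ∎

  ≈ₚ-refl : ∀ {p} → p ≈ₚ p
  ≈ₚ-refl = coeffwise (λ e → refl)

  ≈ₚ-sym : ∀ {p q} → p ≈ₚ q → q ≈ₚ p
  ≈ₚ-sym p≈q = coeffwise (λ e → sym (at p≈q e))

  ≈ₚ-trans : ∀ {p q r} → p ≈ₚ q → q ≈ₚ r → p ≈ₚ r
  ≈ₚ-trans p≈q q≈r = coeffwise (λ e → trans (at p≈q e) (at q≈r e))

  ≡⇒≈ₚ : ∀ {p q} → p ≡ q → p ≈ₚ q
  ≡⇒≈ₚ ≡.refl = ≈ₚ-refl

  ∷-cong : ∀ {r s e p q} → r ≈ s → p ≈ₚ q → (r , e) ∷ p ≈ₚ (s , e) ∷ q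
  ∷-cong {r} {s} {e} {p} {q} r≈s p≈q = coeffwise λ e′ → begin
    coeff F ((r , e) ∷ p) e′   ≈⟨ coeff-∷ r e p e′ ⟩
    δ e e′ r + coeff F p e′  ≈⟨ +-cong (δ-cong e e′ r≈s) (at p≈q e′) ⟩
    δ e e′ s + coeff F q e′  ≈⟨ sym (coeff-∷ s e q e′) ⟩
    coeff F ((s , e) ∷ q) e′   ∎

  +ₚ-cong : ∀ {p p′ q q′} → p ≈ₚ p′ → q ≈ₚ q′ → p +ₚ q ≈ₚ p′ +ₚ q′
  +ₚ-cong {p} {p′} {q} {q′} p≈p′ q≈q′ = coeffwise λ e → begin
    coeff F (p +ₚ q) e            ≈⟨ coeff-+ p q e ⟩
    coeff F p e + coeff F q e     ≈⟨ +-cong (at p≈p′ e) (at q≈q′ e) ⟩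
    coeff F p′ e + coeff F q′ e   ≈⟨ sym (coeff-+ p′ q′ e) ⟩
    coeff F (p′ +ₚ q′) e          ∎

  +ₚ-comm : ∀ p q → p +ₚ q ≈ₚ q +ₚ p
  +ₚ-comm p q = coeffwise λ e → trans (coeff-+ p q e) (trans (+-comm _ _) (sym (coeff-+ q p e)))

  +ₚ-assoc : ∀ p q r → (p +ₚ q) +ₚ r ≈ₚ p +ₚ (q +ₚ r)
  +ₚ-assoc p q r = coeffwise λ e → begin
    coeff F ((p +ₚ q) +ₚ r) e                   ≈⟨ coeff-+ (p +ₚ q) r e ⟩
    coeff F (p +ₚ q) e + coeff F r e            ≈⟨ +-congʳ (coeff-+ p q e) ⟩
    (coeff F p e + coeff F q e) + coeff F r e   ≈⟨ +-assoc _ _ _ ⟩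
    coeff F p e + (coeff F q e + coeff F r e)   ≈⟨ +-congˡ (sym (coeff-+ q r e)) ⟩
    coeff F p e + coeff F (q +ₚ r) e            ≈⟨ sym (coeff-+ p (q +ₚ r) e) ⟩
    coeff F (p +ₚ (q +ₚ r)) e                   ∎

  +ₚ-identityʳ : ∀ p → p +ₚ [] ≈ₚ p
  +ₚ-identityʳ p = coeffwise λ e → trans (coeff-+ p [] e) (+-identityʳ _)

  -ₚ_ : Poly F → Poly F
  -ₚ_ = negP F

  -ₚ-cong : ∀ {p q} → p ≈ₚ q → -ₚ p ≈ₚ -ₚ q
  -ₚ-cong {p} {q} p≈q = coeffwise λ e →
    trans (coeff-scale (- 1#) p e) (trans (*-congˡ (at p≈q e)) (sym (coeff-scale (- 1#) q e)))

  -ₚ-inverseˡ : ∀ p → -ₚ p +ₚ p ≈ₚ []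
  -ₚ-inverseˡ p = coeffwise λ e →
    trans (coeff-+ (-ₚ p) p e) (trans (+-congʳ (trans (coeff-scale (- 1#) p e) (-1*x≈-x _))) (-‿inverseˡ _))
    where open import Algebra.Properties.Ring ring using (-1*x≈-x)

  -ₚ-inverseʳ : ∀ p → p +ₚ -ₚ p ≈ₚ []
  -ₚ-inverseʳ p = ≈ₚ-trans (+ₚ-comm p (-ₚ p)) (-ₚ-inverseˡ p)

  shift : Carrier → Exp F → Poly F → Poly F
  shift r e [] = []
  shift r e ((s , e′) ∷ q) = (r * s , e +ₑ e′) ∷ shift r e q

  _≤ₑ_ : Exp F → Exp F → Set
  (a , b , d) ≤ₑ (a′ , b′ , d′) = (a ℕ.≤ a′) × (b ℕ.≤ b′) × (d ℕ.≤ d′)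

  _≤ₑ?_ : ∀ e e′ → Dec (e ≤ₑ e′)
  (a , b , d) ≤ₑ? (a′ , b′ , d′) = a ℕ.≤? a′ ×-dec (b ℕ.≤? b′ ×-dec d ℕ.≤? d′)

  _∸ₑ_ : Exp F → Exp F → Exp F
  (a , b , d) ∸ₑ (a′ , b′ , d′) = (a ℕ.∸ a′ , b ℕ.∸ b′ , d ℕ.∸ d′)

  +ₑ-≤ₑ : ∀ e e′ → e ≤ₑ (e +ₑ e′)
  +ₑ-≤ₑ (a , b , d) (a′ , b′ , d′) = (ℕ.m≤m+n a a′ , ℕ.m≤m+n b b′ , ℕ.m≤m+n d d′)

  +ₑ-∸ₑ : ∀ e e′ → (e +ₑ e′) ∸ₑ e ≡ e′
  +ₑ-∸ₑ (a , b , d) (a′ , b′ , d′) =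
    ≡.cong₂ _,_ (ℕ.m+n∸m≡n a a′) (≡.cong₂ _,_ (ℕ.m+n∸m≡n b b′) (ℕ.m+n∸m≡n d d′))

  ∸ₑ-+ₑ : ∀ {e e′} → e ≤ₑ e′ → e +ₑ (e′ ∸ₑ e) ≡ e′
  ∸ₑ-+ₑ (a≤ , b≤ , d≤) = ≡.cong₂ _,_ (ℕ.m+[n∸m]≡n a≤) (≡.cong₂ _,_ (ℕ.m+[n∸m]≡n b≤) (ℕ.m+[n∸m]≡n d≤))

  δ-shift : ∀ {e e″} e′ r s → e ≤ₑ e″ → δ (e +ₑ e′) e″ (r * s) ≈ r * δ e′ (e″ ∸ₑ e) s
  δ-shift {e} {e″} e′ r s e≤e″ with (e +ₑ e′) ≟ₑ e″ | e′ ≟ₑ (e″ ∸ₑ e)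
  ... | yes _  | yes _  = refl
  ... | no _   | no _   = sym (zeroʳ r)
  ... | yes eq | no ne  = ⊥-elim (ne (≡.trans (≡.sym (+ₑ-∸ₑ e e′)) (≡.cong (_∸ₑ e) eq)))
  ... | no ne  | yes eq = ⊥-elim (ne (≡.trans (≡.cong (e +ₑ_) eq) (∸ₑ-+ₑ e≤e″)))

  coeff-shift-≤ : ∀ r e q e″ → e ≤ₑ e″ → coeff F (shift r e q) e″ ≈ r * coeff F q (e″ ∸ₑ e)
  coeff-shift-≤ r e [] e″ _ = sym (zeroʳ r)
  coeff-shift-≤ r e ((s , e′) ∷ q) e″ e≤e″ = begin
    coeff F ((r * s , e +ₑ e′) ∷ shift r e q) e″            ≈⟨ coeff-∷ (r * s) (e +ₑ e′) (shift r e q) e″ ⟩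
    δ (e +ₑ e′) e″ (r * s) + coeff F (shift r e q) e″     ≈⟨ +-cong (δ-shift e′ r s e≤e″) (coeff-shift-≤ r e q e″ e≤e″) ⟩
    r * δ e′ (e″ ∸ₑ e) s + r * coeff F q (e″ ∸ₑ e)        ≈⟨ sym (distribˡ r _ _) ⟩
    r * (δ e′ (e″ ∸ₑ e) s + coeff F q (e″ ∸ₑ e))          ≈⟨ *-congˡ (sym (coeff-∷ s e′ q _)) ⟩
    r * coeff F ((s , e′) ∷ q) (e″ ∸ₑ e)                    ∎

  coeff-shift-≰ : ∀ r e q e″ → ¬ e ≤ₑ e″ → coeff F (shift r e q) e″ ≈ 0#
  coeff-shift-≰ r e [] e″ _ = refl
  coeff-shift-≰ r e ((s , e′) ∷ q) e″ e≰e″ = begin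
    coeff F ((r * s , e +ₑ e′) ∷ shift r e q) e″            ≈⟨ coeff-∷ (r * s) (e +ₑ e′) (shift r e q) e″ ⟩
    δ (e +ₑ e′) e″ (r * s) + coeff F (shift r e q) e″     ≈⟨ +-cong (δ-≢ (e +ₑ e′) e″ (r * s) λ eq → e≰e″ (≡.subst (e ≤ₑ_) eq (+ₑ-≤ₑ e e′)))
                                                                      (coeff-shift-≰ r e q e″ e≰e″) ⟩
    0# + 0#                                                 ≈⟨ +-identityˡ 0# ⟩
    0#                                                      ∎

  shift-cong : ∀ r e {q q′} → q ≈ₚ q′ → shift r e q ≈ₚ shift r e q′
  shift-cong r e {q} {q′} q≈q′ = coeffwise λ e″ → at-exponent e″ (e ≤ₑ? e″)
    where
    at-exponent : ∀ e″ → Dec (e ≤ₑ e″) → coeff F (shift r e q) e″ ≈ coeff F (shift r e q′) e″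
    at-exponent e″ (yes e≤e″) = trans (coeff-shift-≤ r e q e″ e≤e″) (trans (*-congˡ (at q≈q′ _)) (sym (coeff-shift-≤ r e q′ e″ e≤e″)))
    at-exponent e″ (no e≰e″)  = trans (coeff-shift-≰ r e q e″ e≰e″) (sym (coeff-shift-≰ r e q′ e″ e≰e″))

  ++≡+ₚ : ∀ p q → p ++ q ≡ p +ₚ q
  ++≡+ₚ [] q = ≡.refl
  ++≡+ₚ (t ∷ p) q = ≡.cong (t ∷_) (++≡+ₚ p q)

  *ₚ-++ : ∀ p p′ q → (p ++ p′) *ₚ q ≡ p *ₚ q ++ p′ *ₚ q
  *ₚ-++ [] p′ q = ≡.refl
  *ₚ-++ (t ∷ p) p′ q = prepend _ (*ₚ-++ p p′ q)
    where
    prepend : ∀ a {x y z} → x ≡ y ++ z → a ++ x ≡ (a ++ y) ++ z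
    prepend a {y = y} {z} eq = ≡.trans (≡.cong (a ++_) eq) (≡.sym (List.++-assoc a y z))

  *ₚ-∷ : ∀ r e p q → ((r , e) ∷ p) *ₚ q ≡ shift r e q +ₚ p *ₚ q
  *ₚ-∷ r e p q = ≡.trans (*ₚ-++ ((r , e) ∷ []) p q)
    (≡.trans (≡.cong (_++ p *ₚ q) (single q)) (++≡+ₚ (shift r e q) (p *ₚ q)))
    where
    single : ∀ q → ((r , e) ∷ []) *ₚ q ≡ shift r e q
    single [] = ≡.refl
    single ((s , e′) ∷ q) = ≡.cong ((r * s , e +ₑ e′) ∷_) (single q)

  *ₚ-distribʳ : ∀ p q r → (q +ₚ r) *ₚ p ≡ q *ₚ p +ₚ r *ₚ p
  *ₚ-distribʳ p q r = ≡.trans (≡.cong (_*ₚ p) (≡.sym (++≡+ₚ q r))) (≡.trans (*ₚ-++ q r p) (++≡+ₚ (q *ₚ p) (r *ₚ p)))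

  shift-+ : ∀ r e p q → shift r e (p +ₚ q) ≡ shift r e p +ₚ shift r e q
  shift-+ r e [] q = ≡.refl
  shift-+ r e ((s , e′) ∷ p) q = ≡.cong (_ ∷_) (shift-+ r e p q)

  +ₚ-interchange : ∀ p q r s → (p +ₚ q) +ₚ (r +ₚ s) ≈ₚ (p +ₚ r) +ₚ (q +ₚ s)
  +ₚ-interchange p q r s = coeffwise λ e → begin
    coeff F ((p +ₚ q) +ₚ (r +ₚ s)) e                                   ≈⟨ coeff-+ (p +ₚ q) (r +ₚ s) e ⟩
    coeff F (p +ₚ q) e + coeff F (r +ₚ s) e                           ≈⟨ +-cong (coeff-+ p q e) (coeff-+ r s e) ⟩
    (coeff F p e + coeff F q e) + (coeff F r e + coeff F s e)         ≈⟨ interchange _ _ _ _ ⟩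
    (coeff F p e + coeff F r e) + (coeff F q e + coeff F s e)         ≈⟨ sym (+-cong (coeff-+ p r e) (coeff-+ q s e)) ⟩
    coeff F (p +ₚ r) e + coeff F (q +ₚ s) e                           ≈⟨ sym (coeff-+ (p +ₚ r) (q +ₚ s) e) ⟩
    coeff F ((p +ₚ r) +ₚ (q +ₚ s)) e                                   ∎
    where open import Algebra.Properties.CommutativeSemigroup +-commutativeSemigroup using (interchange)

  *ₚ-distribˡ : ∀ p q r → p *ₚ (q +ₚ r) ≈ₚ p *ₚ q +ₚ p *ₚ r
  *ₚ-distribˡ [] q r = ≈ₚ-refl
  *ₚ-distribˡ ((s , e) ∷ p) q r =
    ≈ₚ-trans (≡⇒≈ₚ (≡.trans (*ₚ-∷ s e p (q +ₚ r)) (≡.cong (_+ₚ p *ₚ (q +ₚ r)) (shift-+ s e q r))))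
    (≈ₚ-trans (+ₚ-cong ≈ₚ-refl (*ₚ-distribˡ p q r))
    (≈ₚ-trans (+ₚ-interchange (shift s e q) (shift s e r) (p *ₚ q) (p *ₚ r))
    (≡⇒≈ₚ (≡.sym (≡.cong₂ _+ₚ_ (*ₚ-∷ s e p q) (*ₚ-∷ s e p r))))))

  *ₚ-zeroʳ : ∀ p → p *ₚ [] ≡ []
  *ₚ-zeroʳ [] = ≡.refl
  *ₚ-zeroʳ ((r , e) ∷ p) = ≡.trans (*ₚ-∷ r e p []) (*ₚ-zeroʳ p)

  +ₑ-comm : ∀ e e′ → e +ₑ e′ ≡ e′ +ₑ e
  +ₑ-comm (a , b , d) (a′ , b′ , d′) = ≡.cong₂ _,_ (ℕ.+-comm a a′) (≡.cong₂ _,_ (ℕ.+-comm b b′) (ℕ.+-comm d d′))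

  +ₑ-assoc : ∀ e e′ e″ → (e +ₑ e′) +ₑ e″ ≡ e +ₑ (e′ +ₑ e″)
  +ₑ-assoc (a , b , d) (a′ , b′ , d′) (a″ , b″ , d″) =
    ≡.cong₂ _,_ (ℕ.+-assoc a a′ a″) (≡.cong₂ _,_ (ℕ.+-assoc b b′ b″) (ℕ.+-assoc d d′ d″))

  ∷-cong-≡ : ∀ {r s e e′ p q} → r ≈ s → e ≡ e′ → p ≈ₚ q → (r , e) ∷ p ≈ₚ (s , e′) ∷ q
  ∷-cong-≡ r≈s ≡.refl = ∷-cong r≈s

  shift-*ₚ-term : ∀ r e q → shift r e q ≈ₚ q *ₚ ((r , e) ∷ [])
  shift-*ₚ-term r e [] = ≈ₚ-refl
  shift-*ₚ-term r e ((s , e′) ∷ q) =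
    ≈ₚ-trans (∷-cong-≡ (*-comm r s) (+ₑ-comm e e′) (shift-*ₚ-term r e q)) (≡⇒≈ₚ (≡.sym (*ₚ-∷ s e′ q _)))

  *ₚ-comm : ∀ p q → p *ₚ q ≈ₚ q *ₚ p
  *ₚ-comm [] q = ≡⇒≈ₚ (≡.sym (*ₚ-zeroʳ q))
  *ₚ-comm ((r , e) ∷ p) q =
    ≈ₚ-trans (≡⇒≈ₚ (*ₚ-∷ r e p q))
    (≈ₚ-trans (+ₚ-cong (shift-*ₚ-term r e q) (*ₚ-comm p q))
    (≈ₚ-sym (*ₚ-distribˡ q ((r , e) ∷ []) p)))

  shift-shift : ∀ r e s e′ q → shift (r * s) (e +ₑ e′) q ≈ₚ shift r e (shift s e′ q)
  shift-shift r e s e′ [] = ≈ₚ-refl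
  shift-shift r e s e′ ((u , e″) ∷ q) = ∷-cong-≡ (*-assoc r s u) (+ₑ-assoc e e′ e″) (shift-shift r e s e′ q)

  shift-*ₚ : ∀ r e q q′ → shift r e q *ₚ q′ ≈ₚ shift r e (q *ₚ q′)
  shift-*ₚ r e [] q′ = ≈ₚ-refl
  shift-*ₚ r e ((s , e′) ∷ q) q′ =
    ≈ₚ-trans (≡⇒≈ₚ (*ₚ-∷ (r * s) (e +ₑ e′) (shift r e q) q′))
    (≈ₚ-trans (+ₚ-cong (shift-shift r e s e′ q′) (shift-*ₚ r e q q′))
    (≡⇒≈ₚ (≡.sym (≡.trans (≡.cong (shift r e) (*ₚ-∷ s e′ q q′)) (shift-+ r e (shift s e′ q′) (q *ₚ q′))))))

  *ₚ-assoc : ∀ p q r → (p *ₚ q) *ₚ r ≈ₚ p *ₚ (q *ₚ r)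
  *ₚ-assoc [] q r = ≈ₚ-refl
  *ₚ-assoc ((s , e) ∷ p) q r =
    ≈ₚ-trans (≡⇒≈ₚ (≡.trans (≡.cong (_*ₚ r) (*ₚ-∷ s e p q)) (*ₚ-distribʳ r (shift s e q) (p *ₚ q))))
    (≈ₚ-trans (+ₚ-cong (shift-*ₚ s e q r) (*ₚ-assoc p q r))
    (≡⇒≈ₚ (≡.sym (*ₚ-∷ s e p (q *ₚ r)))))

  1ₚ : Poly F
  1ₚ = 1P F

  *ₚ-identityˡ : ∀ p → 1ₚ *ₚ p ≈ₚ p
  *ₚ-identityˡ p = ≈ₚ-trans (≡⇒≈ₚ (*ₚ-∷ 1# (0 , 0 , 0) [] p)) (≈ₚ-trans (+ₚ-identityʳ _) (shift-one p))
    where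
    shift-one : ∀ q → shift 1# (0 , 0 , 0) q ≈ₚ q
    shift-one [] = ≈ₚ-refl
    shift-one ((s , e) ∷ q) = ∷-cong (*-identityˡ s) (shift-one q)

  *ₚ-congˡ : ∀ p {q q′} → q ≈ₚ q′ → p *ₚ q ≈ₚ p *ₚ q′
  *ₚ-congˡ [] q≈q′ = ≈ₚ-refl
  *ₚ-congˡ ((r , e) ∷ p) {q} {q′} q≈q′ =
    ≈ₚ-trans (≡⇒≈ₚ (*ₚ-∷ r e p q)) (≈ₚ-trans (+ₚ-cong (shift-cong r e q≈q′) (*ₚ-congˡ p q≈q′)) (≡⇒≈ₚ (≡.sym (*ₚ-∷ r e p q′))))

  *ₚ-cong : ∀ {p p′ q q′} → p ≈ₚ p′ → q ≈ₚ q′ → p *ₚ q ≈ₚ p′ *ₚ q′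
  *ₚ-cong {p} {p′} {q} {q′} p≈p′ q≈q′ =
    ≈ₚ-trans (*ₚ-congˡ p q≈q′) (≈ₚ-trans (*ₚ-comm p q′) (≈ₚ-trans (*ₚ-congˡ q′ p≈p′) (*ₚ-comm q′ p′)))

  *ₚ-congʳ : ∀ {p p′} q → p ≈ₚ p′ → p *ₚ q ≈ₚ p′ *ₚ q
  *ₚ-congʳ q p≈p′ = *ₚ-cong p≈p′ ≈ₚ-refl

  Poly-commutativeRing : CommutativeRing c ℓ
  Poly-commutativeRing = record
    { Carrier = Poly F ; _≈_ = _≈ₚ_ ; _+_ = _+ₚ_ ; _*_ = _*ₚ_ ; -_ = -ₚ_ ; 0# = [] ; 1# = 1ₚ
    ; isCommutativeRing = record
      { isRing = record
        { +-isAbelianGroup = record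
          { isGroup = record
            { isMonoid = record
              { isSemigroup = record
                { isMagma = record
                  { isEquivalence = record { refl = ≈ₚ-refl ; sym = ≈ₚ-sym ; trans = ≈ₚ-trans }
                  ; ∙-cong = +ₚ-cong }
                ; assoc = +ₚ-assoc }
              ; identity = (λ p → ≈ₚ-refl) , +ₚ-identityʳ }
            ; inverse = -ₚ-inverseˡ , -ₚ-inverseʳ
            ; ⁻¹-cong = -ₚ-cong }
          ; comm = +ₚ-comm }
        ; *-cong = *ₚ-cong
        ; *-assoc = *ₚ-assoc
        ; *-identity = *ₚ-identityˡ , (λ p → ≈ₚ-trans (*ₚ-comm p 1ₚ) (*ₚ-identityˡ p))
        ; distrib = *ₚ-distribˡ , (λ p q r → ≡⇒≈ₚ (*ₚ-distribʳ p q r)) }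
      ; *-comm = *ₚ-comm } }

  module ℙ = CommutativeRing Poly-commutativeRing
  module ≈ₚ-Reasoning = ≈-Reasoning ℙ.setoid
  module ℙ-Solver = IntegerCoefficients Poly-commutativeRing

  open IntegerCoefficients commutativeRing using (solve; _:=_; _:+_; _:*_)
  open Vectors F using (K³)

  monomial : Exp F → K³ → Carrier
  monomial (a , b , d) (x , y , z) = _^_ F x a * (_^_ F y b * _^_ F z d)

  ^-+ : ∀ x m n → _^_ F x (m ℕ.+ n) ≈ _^_ F x m * _^_ F x n
  ^-+ x zero n = sym (*-identityˡ _)
  ^-+ x (suc m) n = trans (*-congˡ (^-+ x m n)) (sym (*-assoc _ _ _))

  monomial-+ : ∀ e e′ v → monomial (e +ₑ e′) v ≈ monomial e v * monomial e′ v
  monomial-+ (a , b , d) (a′ , b′ , d′) (x , y , z) =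
    trans (*-cong (^-+ x a a′) (*-cong (^-+ y b b′) (^-+ z d d′)))
      (solve 6 (λ A A′ B B′ D D′ → (A :* A′) :* ((B :* B′) :* (D :* D′)) := (A :* (B :* D)) :* (A′ :* (B′ :* D′)))
        refl _ _ _ _ _ _)

  eval-∷ : ∀ r e p v → eval F ((r , e) ∷ p) v ≈ r * monomial e v + eval F p v
  eval-∷ r (a , b , d) p (x , y , z) = refl

  eval-+ : ∀ p q v → eval F (p +ₚ q) v ≈ eval F p v + eval F q v
  eval-+ [] q v = sym (+-identityˡ _)
  eval-+ ((r , e) ∷ p) q v = begin
    eval F ((r , e) ∷ (p +ₚ q)) v                  ≈⟨ eval-∷ r e (p +ₚ q) v ⟩
    r * monomial e v + eval F (p +ₚ q) v           ≈⟨ +-congˡ (eval-+ p q v) ⟩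
    r * monomial e v + (eval F p v + eval F q v)   ≈⟨ sym (+-assoc _ _ _) ⟩
    (r * monomial e v + eval F p v) + eval F q v   ≈⟨ +-congʳ (sym (eval-∷ r e p v)) ⟩
    eval F ((r , e) ∷ p) v + eval F q v            ∎

  eval-scale : ∀ s p v → eval F (scaleP F s p) v ≈ s * eval F p v
  eval-scale s [] v = sym (zeroʳ s)
  eval-scale s ((r , e) ∷ p) v = begin
    eval F ((s * r , e) ∷ scaleP F s p) v          ≈⟨ eval-∷ (s * r) e (scaleP F s p) v ⟩
    s * r * monomial e v + eval F (scaleP F s p) v ≈⟨ +-cong (*-assoc _ _ _) (eval-scale s p v) ⟩
    s * (r * monomial e v) + s * eval F p v        ≈⟨ sym (distribˡ s _ _) ⟩
    s * (r * monomial e v + eval F p v)            ≈⟨ *-congˡ (sym (eval-∷ r e p v)) ⟩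
    s * eval F ((r , e) ∷ p) v                     ∎

  eval-shift : ∀ r e q v → eval F (shift r e q) v ≈ (r * monomial e v) * eval F q v
  eval-shift r e [] v = sym (zeroʳ _)
  eval-shift r e ((s , e′) ∷ q) v = begin
    eval F ((r * s , e +ₑ e′) ∷ shift r e q) v                      ≈⟨ eval-∷ (r * s) (e +ₑ e′) (shift r e q) v ⟩
    r * s * monomial (e +ₑ e′) v + eval F (shift r e q) v            ≈⟨ +-cong (*-congˡ (monomial-+ e e′ v)) (eval-shift r e q v) ⟩
    r * s * (monomial e v * monomial e′ v) + r * monomial e v * eval F q v
      ≈⟨ solve 5 (λ R S M M′ Q → R :* S :* (M :* M′) :+ R :* M :* Q := R :* M :* (S :* M′ :+ Q)) refl r s (monomial e v) (monomial e′ v) (eval F q v) ⟩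
    r * monomial e v * (s * monomial e′ v + eval F q v)              ≈⟨ *-congˡ (sym (eval-∷ s e′ q v)) ⟩
    r * monomial e v * eval F ((s , e′) ∷ q) v                       ∎

  eval-* : ∀ p q v → eval F (p *ₚ q) v ≈ eval F p v * eval F q v
  eval-* [] q v = sym (zeroˡ _)
  eval-* ((r , e) ∷ p) q v = begin
    eval F (((r , e) ∷ p) *ₚ q) v                              ≈⟨ reflexive (≡.cong (λ s → eval F s v) (*ₚ-∷ r e p q)) ⟩
    eval F (shift r e q +ₚ p *ₚ q) v                           ≈⟨ eval-+ (shift r e q) (p *ₚ q) v ⟩
    eval F (shift r e q) v + eval F (p *ₚ q) v                 ≈⟨ +-cong (eval-shift r e q v) (eval-* p q v) ⟩
    r * monomial e v * eval F q v + eval F p v * eval F q v    ≈⟨ sym (distribʳ _ _ _) ⟩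
    (r * monomial e v + eval F p v) * eval F q v               ≈⟨ *-congʳ (sym (eval-∷ r e p v)) ⟩
    eval F ((r , e) ∷ p) v * eval F q v                        ∎

  remove : Exp F → Poly F → Poly F
  remove e [] = []
  remove e ((r , e′) ∷ p) with e′ ≟ₑ e
  ... | yes _ = remove e p
  ... | no _  = (r , e′) ∷ remove e p

  eval-remove : ∀ e p v → eval F p v ≈ coeff F p e * monomial e v + eval F (remove e p) v
  eval-remove e [] v = sym (trans (+-identityʳ _) (zeroˡ _))
  eval-remove e ((r , e′) ∷ p) v with e′ ≟ₑ e
  ... | yes ≡.refl = begin
    eval F ((r , e) ∷ p) v                                               ≈⟨ eval-∷ r e p v ⟩
    r * monomial e v + eval F p v                                        ≈⟨ +-congˡ (eval-remove e p v) ⟩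
    r * monomial e v + (coeff F p e * monomial e v + eval F (remove e p) v) ≈⟨ sym (+-assoc _ _ _) ⟩
    (r * monomial e v + coeff F p e * monomial e v) + eval F (remove e p) v ≈⟨ +-congʳ (sym (distribʳ _ _ _)) ⟩
    (r + coeff F p e) * monomial e v + eval F (remove e p) v             ≈⟨ +-congʳ (*-congʳ (sym (trans (coeff-∷ r e p e) (+-congʳ (δ-≡ e e r ≡.refl))))) ⟩
    coeff F ((r , e) ∷ p) e * monomial e v + eval F (remove e p) v       ∎
  ... | no e′≢e = begin
    eval F ((r , e′) ∷ p) v                                              ≈⟨ eval-∷ r e′ p v ⟩
    r * monomial e′ v + eval F p v                                       ≈⟨ +-congˡ (eval-remove e p v) ⟩
    r * monomial e′ v + (coeff F p e * monomial e v + eval F (remove e p) v) ≈⟨ x+[y+z]≈y+[x+z] _ _ _ ⟩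
    coeff F p e * monomial e v + (r * monomial e′ v + eval F (remove e p) v) ≈⟨ +-cong (*-congʳ (sym coeff-e)) (sym (eval-∷ r e′ (remove e p) v)) ⟩
    coeff F ((r , e′) ∷ p) e * monomial e v + eval F ((r , e′) ∷ remove e p) v ∎
    where
    coeff-e : coeff F ((r , e′) ∷ p) e ≈ coeff F p e
    coeff-e = trans (coeff-∷ r e′ p e) (trans (+-congʳ (δ-≢ e′ e r e′≢e)) (+-identityˡ _))
    x+[y+z]≈y+[x+z] : ∀ x y z → x + (y + z) ≈ y + (x + z)
    x+[y+z]≈y+[x+z] x y z = trans (sym (+-assoc x y z)) (trans (+-congʳ (+-comm x y)) (+-assoc y x z))

  coeff-remove-≡ : ∀ e p → coeff F (remove e p) e ≈ 0#
  coeff-remove-≡ e [] = refl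
  coeff-remove-≡ e ((r , e′) ∷ p) with e′ ≟ₑ e
  ... | yes _   = coeff-remove-≡ e p
  ... | no e′≢e = trans (coeff-∷ r e′ (remove e p) e) (trans (+-congʳ (δ-≢ e′ e r e′≢e)) (trans (+-identityˡ _) (coeff-remove-≡ e p)))

  coeff-remove-≢ : ∀ e p e″ → ¬ e ≡ e″ → coeff F (remove e p) e″ ≈ coeff F p e″
  coeff-remove-≢ e [] e″ _ = refl
  coeff-remove-≢ e ((r , e′) ∷ p) e″ e≢e″ with e′ ≟ₑ e
  ... | yes ≡.refl = trans (coeff-remove-≢ e p e″ e≢e″) (sym (trans (coeff-∷ r e p e″) (trans (+-congʳ (δ-≢ e e″ r e≢e″)) (+-identityˡ _))))
  ... | no _ = trans (coeff-∷ r e′ (remove e p) e″) (trans (+-congˡ (coeff-remove-≢ e p e″ e≢e″)) (sym (coeff-∷ r e′ p e″)))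

  length-remove : ∀ e p → List.length (remove e p) ℕ.≤ List.length p
  length-remove e [] = ℕ.z≤n
  length-remove e ((r , e′) ∷ p) with e′ ≟ₑ e
  ... | yes _ = ℕ.m≤n⇒m≤1+n (length-remove e p)
  ... | no _  = ℕ.s≤s (length-remove e p)

  -- induction on the length of p, removing at once all terms with the exponent of the head
  eval-≈ₚ[] : ∀ p v → p ≈ₚ [] → eval F p v ≈ 0#
  eval-≈ₚ[] p v = by-length (List.length p) p ℕ.≤-refl
    where
    by-length : ∀ n p → List.length p ℕ.≤ n → p ≈ₚ [] → eval F p v ≈ 0#
    by-length n [] _ _ = refl
    by-length (suc n) p@((r , e) ∷ p′) (ℕ.s≤s len≤n) p≈0 = begin
      eval F p v                                               ≈⟨ eval-remove e p v ⟩
      coeff F p e * monomial e v + eval F (remove e p) v       ≈⟨ +-cong (*-congʳ (at p≈0 e)) (by-length n (remove e p) len≤ removed≈0) ⟩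
      0# * monomial e v + 0#                                   ≈⟨ trans (+-identityʳ _) (zeroˡ _) ⟩
      0#                                                       ∎
      where
      len≤ : List.length (remove e p) ℕ.≤ n
      len≤ with e ≟ₑ e
      ... | yes _ = ℕ.≤-trans (length-remove e p′) len≤n
      ... | no e≢e = ⊥-elim (e≢e ≡.refl)
      removed≈0 : remove e p ≈ₚ []
      removed≈0 = coeffwise λ e″ → case e ≟ₑ e″ of λ where
        (yes ≡.refl) → coeff-remove-≡ e p
        (no e≢e″)    → trans (coeff-remove-≢ e p e″ e≢e″) (at p≈0 e″)

  eval-cong : ∀ {p q} v → p ≈ₚ q → eval F p v ≈ eval F q v
  eval-cong {p} {q} v p≈q = x∙y⁻¹≈ε⇒x≈y _ _ (begin
    eval F p v - eval F q v                    ≈⟨ +-congˡ (sym (trans (eval-scale (- 1#) q v) (-1*x≈-x _))) ⟩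
    eval F p v + eval F (-ₚ q) v               ≈⟨ sym (eval-+ p (-ₚ q) v) ⟩
    eval F (p +ₚ -ₚ q) v                       ≈⟨ eval-≈ₚ[] (p +ₚ -ₚ q) v (≈ₚ-trans (+ₚ-cong p≈q ≈ₚ-refl) (-ₚ-inverseʳ q)) ⟩
    0#                                         ∎)
    where open import Algebra.Properties.Ring ring using (-1*x≈-x; x∙y⁻¹≈ε⇒x≈y)

  OfDegree : ℕ → Poly F → Set c
  OfDegree t = All (λ term → deg F (proj₂ term) ≡ t)

  coeff-homComp-≡ : ∀ t p e → deg F e ≡ t → coeff F (homComp F t p) e ≈ coeff F p e
  coeff-homComp-≡ t [] e _ = refl
  coeff-homComp-≡ t ((r , e′) ∷ p) e deg≡t with deg F e′ ℕ.≟ t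
  ... | yes _ = trans (coeff-∷ r e′ (homComp F t p) e) (trans (+-congˡ (coeff-homComp-≡ t p e deg≡t)) (sym (coeff-∷ r e′ p e)))
  ... | no deg≢t = trans (coeff-homComp-≡ t p e deg≡t)
                     (sym (trans (coeff-∷ r e′ p e) (trans (+-congʳ (δ-≢ e′ e r λ { ≡.refl → deg≢t deg≡t })) (+-identityˡ _))))

  coeff-homComp-≢ : ∀ t p e → ¬ deg F e ≡ t → coeff F (homComp F t p) e ≈ 0#
  coeff-homComp-≢ t [] e _ = refl
  coeff-homComp-≢ t ((r , e′) ∷ p) e deg≢t with deg F e′ ℕ.≟ t
  ... | yes deg≡t = trans (coeff-∷ r e′ (homComp F t p) e)
                      (trans (+-cong (δ-≢ e′ e r λ { ≡.refl → deg≢t deg≡t }) (coeff-homComp-≢ t p e deg≢t)) (+-identityˡ 0#))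
  ... | no _ = coeff-homComp-≢ t p e deg≢t

  homComp-cong : ∀ t {p q} → p ≈ₚ q → homComp F t p ≈ₚ homComp F t q
  homComp-cong t {p} {q} p≈q = coeffwise λ e → case deg F e ℕ.≟ t of λ where
    (yes deg≡t) → trans (coeff-homComp-≡ t p e deg≡t) (trans (at p≈q e) (sym (coeff-homComp-≡ t q e deg≡t)))
    (no deg≢t)  → trans (coeff-homComp-≢ t p e deg≢t) (sym (coeff-homComp-≢ t q e deg≢t))

  homComp-ofDegree : ∀ t p → OfDegree t (homComp F t p)
  homComp-ofDegree t [] = []
  homComp-ofDegree t ((r , e) ∷ p) with deg F e ℕ.≟ t
  ... | yes deg≡t = deg≡t ∷ homComp-ofDegree t p
  ... | no _      = homComp-ofDegree t p

  homComp-ofDegree-≡ : ∀ {t p} → OfDegree t p → homComp F t p ≡ p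
  homComp-ofDegree-≡ [] = ≡.refl
  homComp-ofDegree-≡ {t} {(r , e) ∷ p} (deg≡t ∷ ps) with deg F e ℕ.≟ t
  ... | yes _     = ≡.cong ((r , e) ∷_) (homComp-ofDegree-≡ ps)
  ... | no deg≢t  = ⊥-elim (deg≢t deg≡t)

  homComp-ofDegree-≢ : ∀ {t p} t′ → OfDegree t p → ¬ t′ ≡ t → homComp F t′ p ≡ []
  homComp-ofDegree-≢ t′ [] _ = ≡.refl
  homComp-ofDegree-≢ {t} {(r , e) ∷ p} t′ (deg≡t ∷ ps) t′≢t with deg F e ℕ.≟ t′
  ... | yes deg≡t′ = ⊥-elim (t′≢t (≡.trans (≡.sym deg≡t′) deg≡t))
  ... | no _       = homComp-ofDegree-≢ t′ ps t′≢t

  ofDegree-vanishesAt : ∀ {t p} → OfDegree t p → (P : Point F) → eval F p (proj₁ P) ≈ 0# → VanishesAt F p P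
  ofDegree-vanishesAt {t} {p} p-deg (v , _) p[v]≈0 t′ with t′ ℕ.≟ t
  ... | yes ≡.refl = trans (reflexive (≡.cong (λ q → eval F q v) (homComp-ofDegree-≡ p-deg))) p[v]≈0
  ... | no t′≢t    = reflexive (≡.cong (λ q → eval F q v) (homComp-ofDegree-≢ t′ p-deg t′≢t))

  OfDegree-+ : ∀ {t p q} → OfDegree t p → OfDegree t q → OfDegree t (p +ₚ q)
  OfDegree-+ [] q-deg = q-deg
  OfDegree-+ (d ∷ p-deg) q-deg = d ∷ OfDegree-+ p-deg q-deg

  deg-+ : ∀ e e′ → deg F (e +ₑ e′) ≡ deg F e ℕ.+ deg F e′
  deg-+ (a , b , d) (a′ , b′ , d′) = +-lemma a a′ b b′ d d′
    where
    open import Data.Nat.Tactic.RingSolver using (solve-∀)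
    +-lemma : ∀ a a′ b b′ d d′ → (a ℕ.+ a′) ℕ.+ (b ℕ.+ b′) ℕ.+ (d ℕ.+ d′) ≡ a ℕ.+ b ℕ.+ d ℕ.+ (a′ ℕ.+ b′ ℕ.+ d′)
    +-lemma = solve-∀

  OfDegree-* : ∀ {s t p q} → OfDegree s p → OfDegree t q → OfDegree (s ℕ.+ t) (p *ₚ q)
  OfDegree-* {s} {t} {[]} [] q-deg = []
  OfDegree-* {s} {t} {(r , e) ∷ p} {q} (e-deg ∷ p-deg) q-deg =
    ≡.subst (OfDegree (s ℕ.+ t)) (≡.sym (*ₚ-∷ r e p q)) (OfDegree-+ (shifted q q-deg) (OfDegree-* p-deg q-deg))
    where
    shifted : ∀ q → OfDegree t q → OfDegree (s ℕ.+ t) (shift r e q)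
    shifted [] [] = []
    shifted ((u , e′) ∷ q) (e′-deg ∷ q-deg) = ≡.trans (deg-+ e e′) (≡.cong₂ ℕ._+_ e-deg e′-deg) ∷ shifted q q-deg

  maxDeg : Poly F → ℕ
  maxDeg [] = 0
  maxDeg ((r , e) ∷ p) = deg F e ℕ.⊔ maxDeg p

  coeff->maxDeg : ∀ p e → maxDeg p ℕ.< deg F e → coeff F p e ≈ 0#
  coeff->maxDeg [] e _ = refl
  coeff->maxDeg ((r , e′) ∷ p) e max<deg = begin
    coeff F ((r , e′) ∷ p) e     ≈⟨ coeff-∷ r e′ p e ⟩
    δ e′ e r + coeff F p e     ≈⟨ +-cong (δ-≢ e′ e r e′≢e) (coeff->maxDeg p e (ℕ.≤-<-trans (ℕ.m≤n⊔m (deg F e′) (maxDeg p)) max<deg)) ⟩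
    0# + 0#                      ≈⟨ +-identityˡ 0# ⟩
    0#                           ∎
    where
    e′≢e : ¬ e′ ≡ e
    e′≢e ≡.refl = ℕ.<-irrefl ≡.refl (ℕ.≤-<-trans (ℕ.m≤m⊔n (deg F e′) (maxDeg p)) max<deg)

  components : ℕ → Poly F → Poly F
  components zero p = homComp F 0 p
  components (suc n) p = components n p +ₚ homComp F (suc n) p

  coeff-components-> : ∀ n p e → n ℕ.< deg F e → coeff F (components n p) e ≈ 0#
  coeff-components-> zero p e n<deg = coeff-homComp-≢ 0 p e (λ deg≡0 → ℕ.<-irrefl (≡.sym deg≡0) n<deg)
  coeff-components-> (suc n) p e n<deg = begin
    coeff F (components (suc n) p) e                              ≈⟨ coeff-+ (components n p) (homComp F (suc n) p) e ⟩
    coeff F (components n p) e + coeff F (homComp F (suc n) p) e  ≈⟨ +-cong (coeff-components-> n p e (ℕ.<-trans (ℕ.n<1+n n) n<deg))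
                                                                            (coeff-homComp-≢ (suc n) p e (λ deg≡ → ℕ.<-irrefl (≡.sym deg≡) n<deg)) ⟩
    0# + 0#                                                       ≈⟨ +-identityˡ 0# ⟩
    0#                                                            ∎

  coeff-components-≤ : ∀ n p e → deg F e ℕ.≤ n → coeff F (components n p) e ≈ coeff F p e
  coeff-components-≤ zero p e deg≤0 = coeff-homComp-≡ 0 p e (ℕ.n≤0⇒n≡0 deg≤0)
  coeff-components-≤ (suc n) p e deg≤ = trans (coeff-+ (components n p) (homComp F (suc n) p) e) (case deg F e ℕ.≟ suc n of λ where
    (yes deg≡) → trans (+-cong (coeff-components-> n p e (≡.subst (n ℕ.<_) (≡.sym deg≡) (ℕ.n<1+n n))) (coeff-homComp-≡ (suc n) p e deg≡))
                       (+-identityˡ _)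
    (no deg≢)  → trans (+-cong (coeff-components-≤ n p e (ℕ.m<1+n⇒m≤n (ℕ.≤∧≢⇒< deg≤ deg≢))) (coeff-homComp-≢ (suc n) p e deg≢))
                       (+-identityʳ _))

  ≈ₚ-components : ∀ p → p ≈ₚ components (maxDeg p) p
  ≈ₚ-components p = coeffwise λ e → case deg F e ℕ.≤? maxDeg p of λ where
    (yes deg≤) → sym (coeff-components-≤ (maxDeg p) p e deg≤)
    (no deg≰)  → trans (coeff->maxDeg p e (ℕ.≰⇒> deg≰)) (sym (coeff-components-> (maxDeg p) p e (ℕ.≰⇒> deg≰)))

  Homogeneous⇒≈homComp : ∀ {t p} → Homogeneous F t p → p ≈ₚ homComp F t p
  Homogeneous⇒≈homComp {t} {p} p-hom = coeffwise λ e → case deg F e ℕ.≟ t of λ where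
    (yes deg≡t) → sym (coeff-homComp-≡ t p e deg≡t)
    (no deg≢t)  → trans (p-hom e deg≢t) (sym (coeff-homComp-≢ t p e deg≢t))

  VanishesAt-resp : ∀ {p q} → p ≈ₚ q → (P : Point F) → VanishesAt F q P → VanishesAt F p P
  VanishesAt-resp p≈q (v , _) q-vanishes t = trans (eval-cong v (homComp-cong t p≈q)) (q-vanishes t)

module LinearForms {c ℓ : Level} (F : Field c ℓ) where

  open Field F
  open Polynomials F
  open Vectors F
  open IntegerCoefficients commutativeRing using (solve; _:=_; _:+_; _:*_; con)

  x¹ y¹ z¹ 𝟙 : Exp F
  x¹ = (1 , 0 , 0) ; y¹ = (0 , 1 , 0) ; z¹ = (0 , 0 , 1) ; 𝟙 = (0 , 0 , 0)

  lin : K³ → Poly F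
  lin (u₁ , u₂ , u₃) = (u₁ , (1 , 0 , 0)) ∷ (u₂ , (0 , 1 , 0)) ∷ (u₃ , (0 , 0 , 1)) ∷ []

  κ : Carrier → Poly F
  κ r = (r , (0 , 0 , 0)) ∷ []

  eval-lin : ∀ u v → eval F (lin u) v ≈ u · v
  eval-lin (u₁ , u₂ , u₃) (x , y , z) =
    solve 6 (λ u₁ u₂ u₃ x y z → u₁ :* ((x :* con (1 , 0)) :* (con (1 , 0) :* con (1 , 0)))
                                 :+ (u₂ :* (con (1 , 0) :* ((y :* con (1 , 0)) :* con (1 , 0)))
                                 :+ (u₃ :* (con (1 , 0) :* (con (1 , 0) :* (z :* con (1 , 0)))) :+ con (0 , 0)))
                                 := u₁ :* x :+ u₂ :* y :+ u₃ :* z)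
      refl u₁ u₂ u₃ x y z

  eval-κ : ∀ r v → eval F (κ r) v ≈ r
  eval-κ r v = trans (+-identityʳ _) (trans (*-congˡ (trans (*-identityˡ _) (*-identityˡ _))) (*-identityʳ r))

  lin-ofDegree : ∀ u → OfDegree 1 (lin u)
  lin-ofDegree u = ≡.refl ∷ ≡.refl ∷ ≡.refl ∷ []

  lin-cong : ∀ {u w} → u ≈ᵥ w → lin u ≈ₚ lin w
  lin-cong (u₁≈w₁ , u₂≈w₂ , u₃≈w₃) = ∷-cong u₁≈w₁ (∷-cong u₂≈w₂ (∷-cong u₃≈w₃ ≈ₚ-refl))

  coeff-lin : ∀ u₁ u₂ u₃ e → coeff F (lin (u₁ , u₂ , u₃)) e ≈ δ x¹ e u₁ + (δ y¹ e u₂ + (δ z¹ e u₃ + 0#))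
  coeff-lin u₁ u₂ u₃ e = trans (coeff-∷ u₁ x¹ _ e) (+-congˡ (trans (coeff-∷ u₂ y¹ _ e) (+-congˡ (coeff-∷ u₃ z¹ [] e))))

  lin-+ : ∀ u w → lin u +ₚ lin w ≈ₚ lin (u ⊕ w)
  lin-+ (u₁ , u₂ , u₃) (w₁ , w₂ , w₃) = coeffwise λ e → begin
    coeff F (lin (u₁ , u₂ , u₃) +ₚ lin (w₁ , w₂ , w₃)) e
      ≈⟨ trans (coeff-+ (lin (u₁ , u₂ , u₃)) (lin (w₁ , w₂ , w₃)) e) (+-cong (coeff-lin u₁ u₂ u₃ e) (coeff-lin w₁ w₂ w₃ e)) ⟩
    (δ x¹ e u₁ + (δ y¹ e u₂ + (δ z¹ e u₃ + 0#))) + (δ x¹ e w₁ + (δ y¹ e w₂ + (δ z¹ e w₃ + 0#)))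
      ≈⟨ solve 6 (λ a b d a′ b′ d′ → (a :+ (b :+ (d :+ con (0 , 0)))) :+ (a′ :+ (b′ :+ (d′ :+ con (0 , 0))))
                                    := (a :+ a′) :+ ((b :+ b′) :+ ((d :+ d′) :+ con (0 , 0)))) refl _ _ _ _ _ _ ⟩
    (δ x¹ e u₁ + δ x¹ e w₁) + ((δ y¹ e u₂ + δ y¹ e w₂) + ((δ z¹ e u₃ + δ z¹ e w₃) + 0#))
      ≈⟨ sym (+-cong (δ-+ x¹ e u₁ w₁) (+-cong (δ-+ y¹ e u₂ w₂) (+-congʳ (δ-+ z¹ e u₃ w₃)))) ⟩
    δ x¹ e (u₁ + w₁) + (δ y¹ e (u₂ + w₂) + (δ z¹ e (u₃ + w₃) + 0#))
      ≈⟨ sym (coeff-lin (u₁ + w₁) (u₂ + w₂) (u₃ + w₃) e) ⟩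
    coeff F (lin (u₁ + w₁ , u₂ + w₂ , u₃ + w₃)) e ∎
    where open ≈-Reasoning setoid

  κ-* : ∀ r p → κ r *ₚ p ≈ₚ shift r (0 , 0 , 0) p
  κ-* r p = ≈ₚ-trans (≡⇒≈ₚ (*ₚ-∷ r (0 , 0 , 0) [] p)) (+ₚ-identityʳ _)

  κ-lin : ∀ r u → κ r *ₚ lin u ≈ₚ lin (r ⊙ u)
  κ-lin r (u₁ , u₂ , u₃) = κ-* r (lin (u₁ , u₂ , u₃))

  κ-κ : ∀ r s → κ r *ₚ κ s ≈ₚ κ (r * s)
  κ-κ r s = κ-* r (κ s)

  κ-cong : ∀ {r s} → r ≈ s → κ r ≈ₚ κ s
  κ-cong r≈s = ∷-cong r≈s ≈ₚ-refl

  coeff-κ : ∀ r e → coeff F (κ r) e ≈ δ 𝟙 e r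
  coeff-κ r e = trans (coeff-∷ r 𝟙 [] e) (+-identityʳ _)

  κ-+ : ∀ r s → κ r +ₚ κ s ≈ₚ κ (r + s)
  κ-+ r s = coeffwise λ e → trans (coeff-+ (κ r) (κ s) e)
    (trans (+-cong (coeff-κ r e) (coeff-κ s e)) (sym (trans (coeff-κ (r + s) e) (δ-+ 𝟙 e r s))))

  κ-0 : κ 0# ≈ₚ []
  κ-0 = coeffwise λ e → trans (coeff-κ 0# e) (δ-0 𝟙 e)

  κ-scale : ∀ r p → κ r *ₚ p ≈ₚ scaleP F r p
  κ-scale r p = coeffwise λ e → trans (at (κ-* r p) e) (trans (coeff-shift-≤ r (0 , 0 , 0) p e (ℕ.z≤n , ℕ.z≤n , ℕ.z≤n)) (sym (coeff-scale r p e)))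

  eval-κ* : ∀ r p v → eval F (κ r *ₚ p) v ≈ r * eval F p v
  eval-κ* r p v = trans (eval-* (κ r) p v) (*-congʳ (eval-κ r v))

  lin-cramer : ∀ a b d w →
    κ (det a b d) *ₚ lin w ≈ₚ κ (w · a) *ₚ lin (cross b d) +ₚ κ (w · b) *ₚ lin (cross d a) +ₚ κ (w · d) *ₚ lin (cross a b)
  lin-cramer a b d w = begin
    κ (det a b d) *ₚ lin w
      ≈⟨ κ-lin _ w ⟩
    lin (det a b d ⊙ w)
      ≈⟨ lin-cong (cramer a b d w) ⟩
    lin ((w · a) ⊙ cross b d ⊕ (w · b) ⊙ cross d a ⊕ (w · d) ⊙ cross a b)
      ≈⟨ ℙ.sym (ℙ.trans (ℙ.+-cong (lin-+ _ _) ℙ.refl) (lin-+ _ _)) ⟩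
    lin ((w · a) ⊙ cross b d) +ₚ lin ((w · b) ⊙ cross d a) +ₚ lin ((w · d) ⊙ cross a b)
      ≈⟨ ℙ.sym (ℙ.+-cong (ℙ.+-cong (κ-lin _ _) (κ-lin _ _)) (κ-lin _ _)) ⟩
    κ (w · a) *ₚ lin (cross b d) +ₚ κ (w · b) *ₚ lin (cross d a) +ₚ κ (w · d) *ₚ lin (cross a b) ∎
    where open ≈ₚ-Reasoning

  κ-ofDegree : ∀ r → OfDegree 0 (κ r)
  κ-ofDegree r = ≡.refl ∷ []

module Subspaces {c ℓ : Level} (F : Field c ℓ) where

  open Field F hiding (zero)
  open Polynomials F
  open FieldProperties F
  open Vectors F
  open LinearForms F
  open ℙ-Solver using (solve; _:=_; _:*_)
  open import Algebra.Properties.CommutativeMonoid.Sum +-commutativeMonoid using (sum)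

  record Subspace {p} (P : Poly F → Set p) : Set (c ⊔ ℓ ⊔ p) where
    field
      resp  : ∀ {q r} → q ≈ₚ r → P r → P q
      []∈ : P []
      +-closed : ∀ {q r} → P q → P r → P (q +ₚ r)
      κ*-closed : ∀ {q} s → P q → P (κ s *ₚ q)

  combination : ∀ {m} → (Fin m → Carrier) → (Fin m → Poly F) → Poly F
  combination {zero} d B = []
  combination {suc m} d B = κ (d fzero) *ₚ B fzero +ₚ combination (λ i → d (fsuc i)) (λ i → B (fsuc i))

  combination-+ : ∀ {m} d d′ (B : Fin m → Poly F) → combination (λ i → d i + d′ i) B ≈ₚ combination d B +ₚ combination d′ B
  combination-+ {zero} d d′ B = ℙ.sym (ℙ.+-identityʳ [])
  combination-+ {suc m} d d′ B = ℙ.trans (ℙ.+-cong head (combination-+ (tail d) (tail d′) (tail B)))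
                                         (+ₚ-interchange (κ (d fzero) *ₚ B fzero) (κ (d′ fzero) *ₚ B fzero) (rest d) (rest d′))
    where
    tail : ∀ {a} {A : Set a} → (Fin (suc m) → A) → Fin m → A
    tail f i = f (fsuc i)
    rest : (Fin (suc m) → Carrier) → Poly F
    rest x = combination (tail x) (tail B)
    head : κ (d fzero + d′ fzero) *ₚ B fzero ≈ₚ κ (d fzero) *ₚ B fzero +ₚ κ (d′ fzero) *ₚ B fzero
    head = ℙ.trans (*ₚ-congʳ (B fzero) (ℙ.sym (κ-+ (d fzero) (d′ fzero)))) (ℙ.distribʳ (B fzero) (κ (d fzero)) (κ (d′ fzero)))

  combination-κ* : ∀ {m} r d (B : Fin m → Poly F) → combination (λ i → r * d i) B ≈ₚ κ r *ₚ combination d B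
  combination-κ* {zero} r d B = ℙ.sym (ℙ.zeroʳ (κ r))
  combination-κ* {suc m} r d B = ℙ.trans (ℙ.+-cong head (combination-κ* r (λ i → d (fsuc i)) (λ i → B (fsuc i))))
                                         (ℙ.sym (ℙ.distribˡ (κ r) (κ (d fzero) *ₚ B fzero) (combination (λ i → d (fsuc i)) (λ i → B (fsuc i)))))
    where
    head : κ (r * d fzero) *ₚ B fzero ≈ₚ κ r *ₚ (κ (d fzero) *ₚ B fzero)
    head = ℙ.trans (*ₚ-congʳ (B fzero) (ℙ.sym (κ-κ r (d fzero)))) (ℙ.*-assoc (κ r) (κ (d fzero)) (B fzero))

  combination-0 : ∀ {m} (B : Fin m → Poly F) → combination (λ _ → 0#) B ≈ₚ []
  combination-0 {zero} B = ℙ.refl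
  combination-0 {suc m} B =
    ℙ.trans (ℙ.+-cong (ℙ.trans (*ₚ-congʳ (B fzero) κ-0) (ℙ.zeroˡ (B fzero))) (combination-0 (λ i → B (fsuc i)))) (ℙ.+-identityˡ [])

  combination-congˡ : ∀ {m} {d d′} (B : Fin m → Poly F) → (∀ i → d i ≈ d′ i) → combination d B ≈ₚ combination d′ B
  combination-congˡ {zero} B _ = ℙ.refl
  combination-congˡ {suc m} B d≈d′ =
    ℙ.+-cong (*ₚ-congʳ (B fzero) (κ-cong (d≈d′ fzero))) (combination-congˡ (λ i → B (fsuc i)) (λ i → d≈d′ (fsuc i)))

  combination-≈0 : ∀ {m} d (B : Fin m → Poly F) → (∀ i → d i ≈ 0#) → combination d B ≈ₚ []
  combination-≈0 d B d≈0 = ℙ.trans (combination-congˡ B d≈0) (combination-0 B)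

  combination-congʳ : ∀ {m} d {B B′ : Fin m → Poly F} → (∀ i → B i ≈ₚ B′ i) → combination d B ≈ₚ combination d B′
  combination-congʳ {zero} d _ = ℙ.refl
  combination-congʳ {suc m} d {B} {B′} B≈B′ =
    ℙ.+-cong (*ₚ-congˡ (κ (d fzero)) (B≈B′ fzero)) (combination-congʳ (λ i → d (fsuc i)) (λ i → B≈B′ (fsuc i)))

  combination-Σ : ∀ {n m} (c : Fin n → Carrier) (rows : Fin n → Fin m → Carrier) (B : Fin m → Poly F) →
                  combination (λ j → sum (λ i → c i * rows i j)) B ≈ₚ combination c (λ i → combination (rows i) B)
  combination-Σ {zero} c rows B = combination-0 B
  combination-Σ {suc n} c rows B = ℙ.trans (combination-+ (λ j → c fzero * rows fzero j) _ B)
    (ℙ.+-cong (combination-κ* (c fzero) (rows fzero) B) (combination-Σ (λ i → c (fsuc i)) (λ i → rows (fsuc i)) B))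

  combination-ofDegree : ∀ {t m} d (B : Fin m → Poly F) → (∀ i → OfDegree t (B i)) → OfDegree t (combination d B)
  combination-ofDegree {m = zero} d B _ = []
  combination-ofDegree {m = suc m} d B B-deg =
    OfDegree-+ (OfDegree-* (κ-ofDegree (d fzero)) (B-deg fzero)) (combination-ofDegree (λ i → d (fsuc i)) (λ i → B (fsuc i)) (λ i → B-deg (fsuc i)))

  eval-combination≈sum : ∀ {m} d (B : Fin m → Poly F) v → eval F (combination d B) v ≈ sum (λ i → d i * eval F (B i) v)
  eval-combination≈sum {zero} d B v = refl
  eval-combination≈sum {suc m} d B v = trans (eval-+ (κ (d fzero) *ₚ B fzero) _ v)
    (+-cong (eval-κ* (d fzero) (B fzero) v) (eval-combination≈sum (λ i → d (fsuc i)) (λ i → B (fsuc i)) v))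

  eval-combination : ∀ {m} d (B : Fin m → Poly F) v k → (∀ i → i ≢ k → eval F (B i) v ≈ 0#) →
                     eval F (combination d B) v ≈ d k * eval F (B k) v
  eval-combination d B v fzero others≈0 =
    trans (eval-+ (κ (d fzero) *ₚ B fzero) _ v) (trans (+-congˡ (rest≈0 (λ i → d (fsuc i)) (λ i → B (fsuc i)) λ i → others≈0 (fsuc i) λ ()))
      (trans (+-identityʳ _) (eval-κ* (d fzero) (B fzero) v)))
    where
    rest≈0 : ∀ {m} d (B : Fin m → Poly F) → (∀ i → eval F (B i) v ≈ 0#) → eval F (combination d B) v ≈ 0#
    rest≈0 {zero} d B _ = refl
    rest≈0 {suc m} d B B≈0 = trans (eval-+ (κ (d fzero) *ₚ B fzero) _ v)
      (trans (+-cong (trans (eval-κ* (d fzero) (B fzero) v) (trans (*-congˡ (B≈0 fzero)) (zeroʳ _)))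
                     (rest≈0 (λ i → d (fsuc i)) (λ i → B (fsuc i)) (λ i → B≈0 (fsuc i)))) (+-identityʳ 0#))
  eval-combination d B v (fsuc k) others≈0 =
    trans (eval-+ (κ (d fzero) *ₚ B fzero) _ v) (trans (+-congʳ (trans (eval-κ* (d fzero) (B fzero) v) (trans (*-congˡ (others≈0 fzero λ ())) (zeroʳ _))))
      (trans (+-identityˡ _) (eval-combination (λ i → d (fsuc i)) (λ i → B (fsuc i)) v k λ i i≢k → others≈0 (fsuc i) (λ eq → i≢k (Fin.suc-injective eq)))))

  record Span {m} (B : Fin m → Poly F) (p : Poly F) : Set (c ⊔ ℓ) where
    constructor span
    field
      coefficients : Fin m → Carrier
      ≈combination : p ≈ₚ combination coefficients B

  Span-subspace : ∀ {m} (B : Fin m → Poly F) → Subspace (Span B)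
  Span-subspace B = record
    { resp = λ q≈r (span d r≈) → span d (ℙ.trans q≈r r≈)
    ; []∈ = span (λ _ → 0#) (ℙ.sym (combination-0 B))
    ; +-closed = λ (span d q≈) (span d′ r≈) → span (λ i → d i + d′ i) (ℙ.trans (ℙ.+-cong q≈ r≈) (ℙ.sym (combination-+ d d′ B)))
    ; κ*-closed = λ s (span d q≈) → span (λ i → s * d i) (ℙ.trans (*ₚ-congˡ (κ s) q≈) (ℙ.sym (combination-κ* s d B))) }

  Span-element : ∀ {m} (B : Fin m → Poly F) i → Span B (B i)
  Span-element {suc m} B fzero = span (λ { fzero → 1# ; (fsuc _) → 0# }) (ℙ.sym (ℙ.trans
    (ℙ.+-cong (ℙ.*-identityˡ (B fzero)) (combination-0 (λ i → B (fsuc i)))) (ℙ.+-identityʳ (B fzero))))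
  Span-element {suc m} B (fsuc i) with Span-element (λ j → B (fsuc j)) i
  ... | span d Bi≈ = span (λ { fzero → 0# ; (fsuc j) → d j }) (ℙ.sym (ℙ.trans
    (ℙ.+-cong (ℙ.trans (*ₚ-congʳ (B fzero) κ-0) (ℙ.zeroˡ (B fzero))) (ℙ.sym Bi≈)) (ℙ.+-identityˡ (B (fsuc i)))))

  dual-points⇒≈[] : ∀ {m} (B : Fin m → Poly F) (pts : Fin m → K³) →
                    (∀ i → ¬ eval F (B i) (pts i) ≈ 0#) → (∀ i j → j ≢ i → eval F (B j) (pts i) ≈ 0#) →
                    ∀ {p} → Span B p → (∀ i → eval F p (pts i) ≈ 0#) → p ≈ₚ []
  dual-points⇒≈[] B pts diagonal off-diagonal {p} (span d p≈) p-vanishes = ℙ.trans p≈ (combination-≈0 d B d≈0)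
    where
    d≈0 : ∀ i → d i ≈ 0#
    d≈0 i = x*y≈0⇒y≈0 (diagonal i) (trans (*-comm _ _) (trans (sym (eval-combination d B (pts i) i (off-diagonal i)))
                                     (trans (sym (eval-cong (pts i) p≈)) (p-vanishes i))))

  record _⊞_ {p q} (P : Poly F → Set p) (Q : Poly F → Set q) (s : Poly F) : Set (c ⊔ ℓ ⊔ p ⊔ q) where
    constructor ⊞-intro
    field
      {left right} : Poly F
      left∈ : P left
      right∈ : Q right
      ≈sum : s ≈ₚ left +ₚ right

  ⊞-subspace : ∀ {p q} {P : Poly F → Set p} {Q : Poly F → Set q} → Subspace P → Subspace Q → Subspace (P ⊞ Q)
  ⊞-subspace P-sub Q-sub = record
    { resp = λ s≈ (⊞-intro q∈ r∈ ≈q+r) → ⊞-intro q∈ r∈ (ℙ.trans s≈ ≈q+r)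
    ; []∈ = ⊞-intro P.[]∈ Q.[]∈ (ℙ.sym (ℙ.+-identityʳ []))
    ; +-closed = λ (⊞-intro {q} {r} q∈ r∈ ≈₁) (⊞-intro {q′} {r′} q′∈ r′∈ ≈₂) →
        ⊞-intro (P.+-closed q∈ q′∈) (Q.+-closed r∈ r′∈) (ℙ.trans (ℙ.+-cong ≈₁ ≈₂) (+ₚ-interchange q r q′ r′))
    ; κ*-closed = λ s (⊞-intro {q} {r} q∈ r∈ ≈q+r) →
        ⊞-intro (P.κ*-closed s q∈) (Q.κ*-closed s r∈) (ℙ.trans (*ₚ-congˡ (κ s) ≈q+r) (ℙ.distribˡ (κ s) q r)) }
    where
    module P = Subspace P-sub
    module Q = Subspace Q-sub

  prodLin : List K³ → Poly F
  prodLin = foldr (λ v h → lin v *ₚ h) 1ₚ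

  module _ {p} {P : Poly F → Set p} (P-sub : Subspace P) where
    open Subspace P-sub

    combination-closed : ∀ {m} d (B : Fin m → Poly F) → (∀ i → P (B i)) → P (combination d B)
    combination-closed {zero} d B B∈P = []∈
    combination-closed {suc m} d B B∈P =
      +-closed (κ*-closed (d fzero) (B∈P fzero)) (combination-closed (λ i → d (fsuc i)) (λ i → B (fsuc i)) (λ i → B∈P (fsuc i)))

    Span-*ˡ : ∀ {m} {B : Fin m → Poly F} q → (∀ i → P (q *ₚ B i)) → ∀ {r} → Span B r → P (q *ₚ r)
    Span-*ˡ {B = B} q qB∈P (span d r≈) = resp (ℙ.trans (*ₚ-congˡ q r≈) (combination-*ˡ d B)) (combination-closed d _ qB∈P)
      where
      combination-*ˡ : ∀ {m} d (B : Fin m → Poly F) → q *ₚ combination d B ≈ₚ combination d (λ i → q *ₚ B i)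
      combination-*ˡ {zero} d B = ℙ.zeroʳ q
      combination-*ˡ {suc m} d B = ℙ.trans (ℙ.distribˡ q _ _) (ℙ.+-cong
        (solve 3 (λ q a b → q :* (a :* b) := a :* (q :* b)) ℙ.refl q (κ (d fzero)) (B fzero))
        (combination-*ˡ (λ i → d (fsuc i)) (λ i → B (fsuc i))))

    Span-* : ∀ {m} {B : Fin m → Poly F} → (∀ i j → P (B i *ₚ B j)) → ∀ {x y} → Span B x → Span B y → P (x *ₚ y)
    Span-* {B = B} BB∈P {x} {y} x∈ y∈ =
      resp (ℙ.*-comm x y) (Span-*ˡ y (λ i → resp (ℙ.*-comm y (B i)) (Span-*ˡ (B i) (BB∈P i) y∈)) x∈)

    -- every monomial is a product of coordinate linear forms
    forms⊆ : ∀ t → (∀ vs → List.length vs ≡ t → P (prodLin vs)) → ∀ {q} → OfDegree t q → P q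
    forms⊆ t prods∈P {[]} [] = []∈
    forms⊆ t prods∈P {(r , (a , b , d)) ∷ q} (deg≡t ∷ q-deg) =
      +-closed (resp (term≈ r (a , b , d)) (κ*-closed r (prods∈P (coords a b d) (≡.trans (length-coords a b d) deg≡t))))
               (forms⊆ t prods∈P q-deg)
      where
      x-axis y-axis z-axis : K³
      x-axis = (1# , 0# , 0#) ; y-axis = (0# , 1# , 0#) ; z-axis = (0# , 0# , 1#)

      coords : ℕ → ℕ → ℕ → List K³
      coords a b d = replicate a x-axis ++ replicate b y-axis ++ replicate d z-axis

      length-coords : ∀ a b d → List.length (coords a b d) ≡ a ℕ.+ b ℕ.+ d
      length-coords a b d = ≡.trans (List.length-++ (replicate a x-axis))
        (≡.trans (≡.cong₂ ℕ._+_ (List.length-replicate a) (≡.trans (List.length-++ (replicate b y-axis))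
          (≡.cong₂ ℕ._+_ (List.length-replicate b) (List.length-replicate d)))) (≡.sym (ℕ.+-assoc a b d)))

      ∷-0# : ∀ {s} e q → s ≈ 0# → (s , e) ∷ q ≈ₚ q
      ∷-0# {s} e q s≈0 = coeffwise λ e′ → trans (coeff-∷ s e q e′) (trans (+-congʳ (trans (δ-cong e e′ s≈0) (δ-0 e e′))) (+-identityˡ _))

      monic : Exp F → Poly F
      monic e = (1# , e) ∷ []

      x-step : ∀ a b d → lin x-axis *ₚ monic (a , b , d) ≈ₚ monic (suc a , b , d)
      x-step a b d = ∷-cong (*-identityˡ 1#) (≈ₚ-trans (∷-0# _ _ (zeroˡ 1#)) (∷-0# _ _ (zeroˡ 1#)))

      y-step : ∀ a b d → lin y-axis *ₚ monic (a , b , d) ≈ₚ monic (a , suc b , d)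
      y-step a b d = ≈ₚ-trans (∷-0# _ _ (zeroˡ 1#)) (∷-cong (*-identityˡ 1#) (∷-0# _ _ (zeroˡ 1#)))

      z-step : ∀ a b d → lin z-axis *ₚ monic (a , b , d) ≈ₚ monic (a , b , suc d)
      z-step a b d = ≈ₚ-trans (∷-0# _ _ (zeroˡ 1#)) (≈ₚ-trans (∷-0# _ _ (zeroˡ 1#)) (∷-cong (*-identityˡ 1#) ≈ₚ-refl))

      monic≈prodLin : ∀ a b d → monic (a , b , d) ≈ₚ prodLin (coords a b d)
      monic≈prodLin (suc a) b d = ℙ.trans (ℙ.sym (x-step a b d)) (*ₚ-congˡ (lin x-axis) (monic≈prodLin a b d))
      monic≈prodLin zero (suc b) d = ℙ.trans (ℙ.sym (y-step 0 b d)) (*ₚ-congˡ (lin y-axis) (monic≈prodLin 0 b d))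
      monic≈prodLin zero zero (suc d) = ℙ.trans (ℙ.sym (z-step 0 0 d)) (*ₚ-congˡ (lin z-axis) (monic≈prodLin 0 0 d))
      monic≈prodLin zero zero zero = ℙ.refl

      term≈ : ∀ r e → (r , e) ∷ [] ≈ₚ κ r *ₚ prodLin (coords (proj₁ e) (proj₁ (proj₂ e)) (proj₂ (proj₂ e)))
      term≈ r e@(a , b , d) = ℙ.trans (ℙ.sym (ℙ.trans (κ-scale r (monic e)) (∷-cong (*-identityʳ r) ℙ.refl)))
                                      (*ₚ-congˡ (κ r) (monic≈prodLin a b d))

module LinearDependence {c ℓ : Level} (F : Field c ℓ) where

  open Field F
  open FieldProperties F using (_⁻¹[_]; x*x⁻¹≈1)
  open import Algebra.Properties.CommutativeMonoid.Sum +-commutativeMonoid using (sum; sum-remove; ∑-distrib-+; sum-cong-≋)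
  open import Algebra.Properties.Ring ring using (-‿distribˡ-*; -‿+-comm; -0#≈0#)
  open IntegerCoefficients commutativeRing using (solve; _:=_; _:+_; _:*_; :-_)

  IsRelation : ∀ {m n} → (Fin m → Fin n → Carrier) → (Fin m → Carrier) → Set ℓ
  IsRelation v cs = ∀ j → sum (λ i → cs i * v i j) ≈ 0#

  NonTrivial : ∀ {m} → (Fin m → Carrier) → Set ℓ
  NonTrivial cs = ¬ (∀ i → cs i ≈ 0#)

  Dependent : ∀ {m n} → (Fin m → Fin n → Carrier) → Set (c ⊔ ℓ)
  Dependent v = Σ _ λ cs → NonTrivial cs × IsRelation v cs

  private
    -- the double-negation monad, at mixed universe levels
    pure : ∀ {a} {A : Set a} → A → ¬ ¬ A
    pure = contradiction

    _>>=_ : ∀ {a b} {A : Set a} {B : Set b} → ¬ ¬ A → (A → ¬ ¬ B) → ¬ ¬ B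
    m >>= f = negated-stable (¬¬-map f m)

    sum-≈0 : ∀ {m} (f : Fin m → Carrier) → (∀ i → f i ≈ 0#) → sum f ≈ 0#
    sum-≈0 {zero} f _ = refl
    sum-≈0 {suc m} f f≈0 = trans (+-cong (f≈0 fzero) (sum-≈0 (λ i → f (fsuc i)) (λ i → f≈0 (fsuc i)))) (+-identityʳ 0#)

    -sum : ∀ {m} (f : Fin m → Carrier) → - sum f ≈ sum (λ i → - f i)
    -sum {zero} f = -0#≈0#
    -sum {suc m} f = trans (sym (-‿+-comm (f fzero) _)) (+-congˡ (-sum (λ i → f (fsuc i))))

    *-sum : ∀ {m} x (f : Fin m → Carrier) → x * sum f ≈ sum (λ i → x * f i)
    *-sum {zero} x f = zeroʳ x
    *-sum {suc m} x f = trans (distribˡ x _ _) (+-congˡ (*-sum x (λ i → f (fsuc i))))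

    ¬¬-search : ∀ {m} (P : Fin m → Set ℓ) → ¬ ¬ ((Σ (Fin m) λ i → ¬ P i) ⊎ (∀ i → P i))
    ¬¬-search {zero} P = pure (inj₂ λ ())
    ¬¬-search {suc m} P = ¬¬-excluded-middle >>= λ where
      (no ¬P₀) → pure (inj₁ (fzero , ¬P₀))
      (yes P₀) → ¬¬-search (λ i → P (fsuc i)) >>= λ where
        (inj₁ (i , ¬Pᵢ)) → pure (inj₁ (fsuc i , ¬Pᵢ))
        (inj₂ all)      → pure (inj₂ λ { fzero → P₀ ; (fsuc i) → all i })

  ¬¬-dependent : ∀ n (v : Fin (suc n) → Fin n → Carrier) → ¬ ¬ Dependent v
  ¬¬-dependent zero v = pure ((λ _ → 1#) , (λ all≈0 → 0≉1 (sym (all≈0 fzero))) , λ ())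
  ¬¬-dependent (suc n) v = ¬¬-search (λ i → v i fzero ≈ 0#) >>= λ
    { (inj₂ column≈0)      → ¬¬-map (zero-column column≈0) (¬¬-dependent n (λ i j → v (fsuc i) (fsuc j)))
    ; (inj₁ (p , pivot≉0)) → ¬¬-map (with-pivot p pivot≉0) (¬¬-dependent n (eliminate p pivot≉0)) }
    where
    zero-column : (∀ i → v i fzero ≈ 0#) → Dependent (λ i j → v (fsuc i) (fsuc j)) → Dependent v
    zero-column column≈0 (cs , nontrivial , relation) = cs′ , (λ all≈0 → nontrivial (λ i → all≈0 (fsuc i))) , relation′
      where
      cs′ : Fin (suc (suc n)) → Carrier
      cs′ fzero = 0#
      cs′ (fsuc i) = cs i
      relation′ : IsRelation v cs′
      relation′ fzero = sum-≈0 (λ i → cs′ i * v i fzero) λ { fzero → zeroˡ _ ; (fsuc i) → trans (*-congˡ (column≈0 (fsuc i))) (zeroʳ _) }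
      relation′ (fsuc j) = trans (+-cong (zeroˡ _) (relation j)) (+-identityʳ 0#)

    multiplier : ∀ p → ¬ v p fzero ≈ 0# → Fin (suc n) → Carrier
    multiplier p pivot≉0 k = v (punchIn p k) fzero * v p fzero ⁻¹[ pivot≉0 ]

    eliminate : ∀ p → ¬ v p fzero ≈ 0# → Fin (suc n) → Fin n → Carrier
    eliminate p pivot≉0 k j = v (punchIn p k) (fsuc j) - multiplier p pivot≉0 k * v p (fsuc j)

    with-pivot : ∀ p pivot≉0 → Dependent (eliminate p pivot≉0) → Dependent v
    with-pivot p pivot≉0 (cs , nontrivial , relation) = cs′ , nontrivial′ , relation′
      where
      μ = multiplier p pivot≉0
      u : Fin (suc n) → Fin (suc n) → Carrier
      u k = v (punchIn p k)
      cₚ = - sum (λ k → cs k * μ k)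
      cs′ = insertAt cs p cₚ
      nontrivial′ : NonTrivial cs′
      nontrivial′ all≈0 = nontrivial (λ k → trans (reflexive (≡.sym (insertAt-punchIn cs p cₚ k))) (all≈0 (punchIn p k)))
      reduced : ∀ j → sum (λ i → cs′ i * v i j) ≈ sum (λ k → cs k * (u k j - μ k * v p j))
      reduced j = begin
        sum (λ i → cs′ i * v i j)
          ≈⟨ sum-remove {i = p} (λ i → cs′ i * v i j) ⟩
        cs′ p * v p j + sum (λ k → cs′ (punchIn p k) * u k j)
          ≈⟨ +-cong (*-congʳ (reflexive (insertAt-lookup cs p cₚ)))
                    (sum-cong-≋ {x = λ k → cs′ (punchIn p k) * u k j} {y = λ k → cs k * u k j}
                      (λ k → *-congʳ (reflexive (insertAt-punchIn cs p cₚ k)))) ⟩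
        cₚ * v p j + sum (λ k → cs k * u k j)
          ≈⟨ +-congʳ (trans (sym (-‿distribˡ-* (sum (λ k → cs k * μ k)) (v p j))) (-‿cong (trans (*-comm _ _) (*-sum (v p j) (λ k → cs k * μ k))))) ⟩
        - sum (λ k → v p j * (cs k * μ k)) + sum (λ k → cs k * u k j)
          ≈⟨ +-congʳ (trans (-sum (λ k → v p j * (cs k * μ k)))
                            (sum-cong-≋ {x = λ k → - (v p j * (cs k * μ k))} {y = λ k → - (cs k * (μ k * v p j))}
                              λ k → -‿cong (solve 3 (λ a b m → a :* (b :* m) := b :* (m :* a)) refl (v p j) (cs k) (μ k)))) ⟩
        sum (λ k → - (cs k * (μ k * v p j))) + sum (λ k → cs k * u k j)
          ≈⟨ trans (+-comm _ _) (sym (∑-distrib-+ (λ k → cs k * u k j) (λ k → - (cs k * (μ k * v p j))))) ⟩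
        sum (λ k → cs k * u k j + - (cs k * (μ k * v p j)))
          ≈⟨ sum-cong-≋ {x = λ k → cs k * u k j + - (cs k * (μ k * v p j))} {y = λ k → cs k * (u k j - μ k * v p j)}
               (λ k → solve 4 (λ a b m q → a :* b :+ (:- (a :* (m :* q))) := a :* (b :+ (:- (m :* q)))) refl (cs k) (u k j) (μ k) (v p j)) ⟩
        sum (λ k → cs k * (u k j - μ k * v p j)) ∎
        where open ≈-Reasoning setoid
      cleared : ∀ k → u k fzero - μ k * v p fzero ≈ 0#
      cleared k = trans (+-congˡ (-‿cong (trans (*-assoc _ _ _) (trans (*-congˡ (trans (*-comm _ _) (x*x⁻¹≈1 _ pivot≉0))) (*-identityʳ _)))))
                        (-‿inverseʳ _)
      relation′ : IsRelation v cs′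
      relation′ fzero = trans (reduced fzero) (sum-≈0 (λ k → cs k * (u k fzero - μ k * v p fzero)) λ k → trans (*-congˡ (cleared k)) (zeroʳ _))
      relation′ (fsuc j) = trans (reduced (fsuc j)) (relation j)

module Configuration {c ℓ : Level} (F : Field c ℓ) (A : Fin 6 → Point F)
  (distinct : Points.Distinct F A) (general : Points.LinearlyGeneral F A) where

  open Field F
  open Polynomials F
  open FieldProperties F
  open Vectors F
  open LinearForms F
  open import Algebra.Properties.Ring ring using (x∙y⁻¹≈ε⇒x≈y)

  pt : Fin 6 → K³
  pt i = proj₁ (A i)

  Pair : Set
  Pair = Fin 6 × Fin 6

  -- the linear form P ↦ det(pt i, pt j, P), which defines the line through i and j
  line : Pair → Poly F
  line (i , j) = lin (cross (pt i) (pt j))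

  eval-line : ∀ i j v → eval F (line (i , j)) v ≈ det (pt i) (pt j) v
  eval-line i j v = eval-lin (cross (pt i) (pt j)) v

  line-vanishes₁ : ∀ i j → eval F (line (i , j)) (pt i) ≈ 0#
  line-vanishes₁ i j = trans (eval-line i j (pt i)) (cross-·ˡ (pt i) (pt j))

  line-vanishes₂ : ∀ i j → eval F (line (i , j)) (pt j) ≈ 0#
  line-vanishes₂ i j = trans (eval-line i j (pt j)) (cross-·ʳ (pt i) (pt j))

  private
    proportional : ∀ {a b d a′ b′ d′} → ¬ a ≈ 0# → a * b′ ≈ b * a′ → a * d′ ≈ d * a′ →
                   ¬ (a′ ≈ 0# × b′ ≈ 0# × d′ ≈ 0#) →
                   Σ Carrier λ t → ¬ t ≈ 0# × a′ ≈ t * a × b′ ≈ t * b × d′ ≈ t * d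
    proportional {a} {b} {d} {a′} {b′} {d′} a≉0 ab′≈ba′ ad′≈da′ P′≉0 =
      t , t≉0 , scaled a′ a refl , scaled b′ b ab′≈ba′ , scaled d′ d ad′≈da′
      where
      a⁻¹ = a ⁻¹[ a≉0 ]
      t = a′ * a⁻¹
      scaled : ∀ x′ x → a * x′ ≈ x * a′ → x′ ≈ t * x
      scaled x′ x ax′≈xa′ = begin
        x′                  ≈⟨ sym (*-identityˡ x′) ⟩
        1# * x′             ≈⟨ *-congʳ (sym (trans (*-comm _ _) (x*x⁻¹≈1 a a≉0))) ⟩
        a⁻¹ * a * x′        ≈⟨ *-assoc _ _ _ ⟩
        a⁻¹ * (a * x′)      ≈⟨ *-congˡ ax′≈xa′ ⟩
        a⁻¹ * (x * a′)      ≈⟨ solve 3 (λ i x a′ → i :* (x :* a′) := (a′ :* i) :* x) refl a⁻¹ x a′ ⟩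
        t * x               ∎
        where
        open ≈-Reasoning setoid
        open IntegerCoefficients commutativeRing using (solve; _:=_; _:*_)
      t≉0 : ¬ t ≈ 0#
      t≉0 t≈0 = P′≉0 (vanish a′ a refl , vanish b′ b ab′≈ba′ , vanish d′ d ad′≈da′)
        where
        vanish : ∀ x′ x → a * x′ ≈ x * a′ → x′ ≈ 0#
        vanish x′ x eq = trans (scaled x′ x eq) (trans (*-congʳ t≈0) (zeroˡ x))

  cross≉0 : ∀ {i j} → i ≢ j → let (c₁ , c₂ , c₃) = cross (pt i) (pt j) in ¬ (c₁ ≈ 0# × c₂ ≈ 0# × c₃ ≈ 0#)
  cross≉0 {i} {j} i≢j (c₁≈0 , c₂≈0 , c₃≈0) = minors≈0⇒¬¬same (A i) (A j) (distinct i j i≢j) (≈0⇒≈ c₁≈0) (≈0⇒≈ c₂≈0) (≈0⇒≈ c₃≈0)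
    where
    ≈0⇒≈ : ∀ {x y} → x - y ≈ 0# → x ≈ y
    ≈0⇒≈ = x∙y⁻¹≈ε⇒x≈y _ _
    -- the goal is negative, so we may split classically on which coordinate of P is nonzero
    minors≈0⇒¬¬same : ∀ (P Q : Point F) → ¬ SamePoint F P Q → let ((x , y , z) , _) = P ; ((x′ , y′ , z′) , _) = Q in
         y * z′ ≈ z * y′ → z * x′ ≈ x * z′ → x * y′ ≈ y * x′ → ⊥
    minors≈0⇒¬¬same ((x , y , z) , P≉0) ((x′ , y′ , z′) , Q≉0) P≉Q yz′≈zy′ zx′≈xz′ xy′≈yx′ =
      ¬¬-excluded-middle λ where
        (no x≉0) → P≉Q (proportional x≉0 xy′≈yx′ (sym zx′≈xz′) Q≉0)
        (yes x≈0) → ¬¬-excluded-middle λ where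
          (no y≉0) → let (t , t≉0 , y′≈ , z′≈ , x′≈) = proportional y≉0 yz′≈zy′ (sym xy′≈yx′) (λ (b , d , a) → Q≉0 (a , b , d))
                     in P≉Q (t , t≉0 , x′≈ , y′≈ , z′≈)
          (yes y≈0) → ¬¬-excluded-middle λ where
            (no z≉0) → let (t , t≉0 , z′≈ , x′≈ , y′≈) = proportional z≉0 zx′≈xz′ (sym yz′≈zy′) (λ (d , a , b) → Q≉0 (a , b , d))
                       in P≉Q (t , t≉0 , x′≈ , y′≈ , z′≈)
            (yes z≈0) → P≉0 (x≈0 , y≈0 , z≈0)

  lineForm : ∀ {i j} → i ≢ j → LinearForm F
  lineForm {i} {j} i≢j = cross (pt i) (pt j) , cross≉0 i≢j

  det≈0⇒collinear : ∀ {i j} (i≢j : i ≢ j) k → det (pt i) (pt j) (pt k) ≈ 0# → Collinear F (A i) (A j) (A k)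
  det≈0⇒collinear {i} {j} i≢j k det≈0 =
    lineForm i≢j , on i (line-vanishes₁ i j) , on j (line-vanishes₂ i j) , on k (trans (eval-line i j (pt k)) det≈0)
    where
    on : ∀ k → eval F (line (i , j)) (pt k) ≈ 0# → VanishesAt F (line (i , j)) (A k)
    on k = ofDegree-vanishesAt (lin-ofDegree _) (A k)

  det≉0 : ∀ {i j k} → i ≢ j → j ≢ k → i ≢ k → ¬ det (pt i) (pt j) (pt k) ≈ 0#
  det≉0 {i} {j} {k} i≢j j≢k i≢k det≈0 = general i j k i≢j j≢k i≢k (det≈0⇒collinear i≢j k det≈0)

  line-nonvanishing : ∀ {i j k} → i ≢ j → j ≢ k → i ≢ k → ¬ eval F (line (i , j)) (pt k) ≈ 0#
  line-nonvanishing i≢j j≢k i≢k ≈0 = det≉0 i≢j j≢k i≢k (trans (sym (eval-line _ _ _)) ≈0)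

  -- Cramer's rule: the coefficient of each side of the triangle is proportional to the value at the opposite vertex
  lin-in-triangle : ∀ {i j k} → i ≢ j → j ≢ k → i ≢ k → ∀ w →
    Σ (Carrier × Carrier × Carrier) λ (α , β , γ) →
      lin w ≈ₚ κ α *ₚ line (j , k) +ₚ κ β *ₚ line (k , i) +ₚ κ γ *ₚ line (i , j) × (w · pt i ≈ 0# → α ≈ 0#)
  lin-in-triangle {i} {j} {k} i≢j j≢k i≢k w =
    (D⁻¹ * (w · pt i) , D⁻¹ * (w · pt j) , D⁻¹ * (w · pt k)) , expansion , λ w·i≈0 → trans (*-congˡ w·i≈0) (zeroʳ D⁻¹)
    where
    open ℙ-Solver using (solve; _:=_; _:+_; _:*_)
    D = det (pt i) (pt j) (pt k)
    D⁻¹ = D ⁻¹[ det≉0 i≢j j≢k i≢k ]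
    D⁻¹*D≈1 : D⁻¹ * D ≈ 1#
    D⁻¹*D≈1 = trans (*-comm _ _) (x*x⁻¹≈1 D _)
    L₁ = line (j , k) ; L₂ = line (k , i) ; L₃ = line (i , j)
    expansion : lin w ≈ₚ κ (D⁻¹ * (w · pt i)) *ₚ L₁ +ₚ κ (D⁻¹ * (w · pt j)) *ₚ L₂ +ₚ κ (D⁻¹ * (w · pt k)) *ₚ L₃
    expansion = begin
      lin w                                                        ≈⟨ ℙ.sym (ℙ.*-identityˡ (lin w)) ⟩
      1ₚ *ₚ lin w                                                  ≈⟨ *ₚ-congʳ (lin w) (ℙ.sym (ℙ.trans (κ-κ D⁻¹ D) (κ-cong D⁻¹*D≈1))) ⟩
      κ D⁻¹ *ₚ κ D *ₚ lin w                                        ≈⟨ ℙ.*-assoc (κ D⁻¹) (κ D) (lin w) ⟩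
      κ D⁻¹ *ₚ (κ D *ₚ lin w)                                      ≈⟨ *ₚ-congˡ (κ D⁻¹) (lin-cramer (pt i) (pt j) (pt k) w) ⟩
      κ D⁻¹ *ₚ (κ (w · pt i) *ₚ L₁ +ₚ κ (w · pt j) *ₚ L₂ +ₚ κ (w · pt k) *ₚ L₃)
        ≈⟨ solve 7 (λ d a b g l₁ l₂ l₃ → d :* (a :* l₁ :+ b :* l₂ :+ g :* l₃) := (d :* a) :* l₁ :+ (d :* b) :* l₂ :+ (d :* g) :* l₃)
                 ℙ.refl (κ D⁻¹) (κ (w · pt i)) (κ (w · pt j)) (κ (w · pt k)) L₁ L₂ L₃ ⟩
      κ D⁻¹ *ₚ κ (w · pt i) *ₚ L₁ +ₚ κ D⁻¹ *ₚ κ (w · pt j) *ₚ L₂ +ₚ κ D⁻¹ *ₚ κ (w · pt k) *ₚ L₃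
        ≈⟨ ℙ.+-cong (ℙ.+-cong (*ₚ-congʳ L₁ (κ-κ _ _)) (*ₚ-congʳ L₂ (κ-κ _ _))) (*ₚ-congʳ L₃ (κ-κ _ _)) ⟩
      κ (D⁻¹ * (w · pt i)) *ₚ L₁ +ₚ κ (D⁻¹ * (w · pt j)) *ₚ L₂ +ₚ κ (D⁻¹ * (w · pt k)) *ₚ L₃ ∎
      where open ≈ₚ-Reasoning

module Reduction {c ℓ : Level} (F : Field c ℓ) (A : Fin 6 → Point F)
  (distinct : Points.Distinct F A) (general : Points.LinearlyGeneral F A) where

  open Field F hiding (zero)
  open Polynomials F
  open FieldProperties F
  open Vectors F
  open LinearForms F
  open Subspaces F
  open Configuration F A distinct general

  _∈ₗ_ : Fin 6 → Pair → Set
  k ∈ₗ (i , j) = k ≡ i ⊎ k ≡ j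

  _∈ₗ?_ : ∀ k l → Dec (k ∈ₗ l)
  k ∈ₗ? (i , j) = (k Fin.≟ i) ⊎-dec (k Fin.≟ j)

  Proper : Pair → Set
  Proper (i , j) = i ≢ j

  Proper? : ∀ l → Dec (Proper l)
  Proper? (i , j) = ¬? (i Fin.≟ j)

  prodLines : List Pair → Poly F
  prodLines = foldr (λ l h → line l *ₚ h) 1ₚ

  prodLines-vanishes : ∀ {k} ls → Any (k ∈ₗ_) ls → eval F (prodLines ls) (pt k) ≈ 0#
  prodLines-vanishes {k} (l ∷ ls) k∈ =
    trans (eval-* (line l) (prodLines ls) (pt k)) (case k∈ of λ where
      (here (inj₁ ≡.refl)) → trans (*-congʳ (line-vanishes₁ _ _)) (zeroˡ _)
      (here (inj₂ ≡.refl)) → trans (*-congʳ (line-vanishes₂ _ _)) (zeroˡ _)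
      (there k∈ls)         → trans (*-congˡ (prodLines-vanishes ls k∈ls)) (zeroʳ _))

  prodLines-nonvanishing : ∀ {k ls} → All Proper ls → All (λ l → ¬ k ∈ₗ l) ls → ¬ eval F (prodLines ls) (pt k) ≈ 0#
  prodLines-nonvanishing {k} [] [] 1≈0 = 0≉1 (sym (trans (sym (eval-κ 1# (pt k))) 1≈0))
  prodLines-nonvanishing {k} {(i , j) ∷ ls} (i≢j ∷ proper) (k∉ ∷ k∉ls) ≈0 =
    *-nonzero (line-nonvanishing i≢j (λ { ≡.refl → k∉ (inj₂ ≡.refl) }) (λ { ≡.refl → k∉ (inj₁ ≡.refl) }))
              (prodLines-nonvanishing proper k∉ls)
              (trans (sym (eval-* (line (i , j)) (prodLines ls) (pt k))) ≈0)

  record Cover : Set where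
    field
      lines  : List Pair
      proper : All Proper lines
      covers : ∀ k → Any (k ∈ₗ_) lines

  -- J is the ideal generated by the products of lines that together pass through all six points
  Jsum : List (Poly F × Cover) → Poly F
  Jsum = foldr (λ (h , g) acc → h *ₚ prodLines (Cover.lines g) +ₚ acc) []

  record InJ (p : Poly F) : Set (c ⊔ ℓ) where
    constructor inJ
    field
      terms : List (Poly F × Cover)
      ≈Jsum : p ≈ₚ Jsum terms

  Jsum-++ : ∀ hs hs′ → Jsum (hs ++ hs′) ≈ₚ Jsum hs +ₚ Jsum hs′
  Jsum-++ [] hs′ = ℙ.sym (ℙ.+-identityˡ _)
  Jsum-++ ((h , g) ∷ hs) hs′ = ℙ.trans (ℙ.+-cong ℙ.refl (Jsum-++ hs hs′)) (ℙ.sym (ℙ.+-assoc _ (Jsum hs) (Jsum hs′)))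

  Jsum-*ˡ : ∀ q hs → q *ₚ Jsum hs ≈ₚ Jsum (List.map (λ (h , g) → q *ₚ h , g) hs)
  Jsum-*ˡ q [] = ℙ.zeroʳ q
  Jsum-*ˡ q ((h , g) ∷ hs) = ℙ.trans (ℙ.distribˡ q _ (Jsum hs)) (ℙ.+-cong (ℙ.sym (ℙ.*-assoc q h _)) (Jsum-*ˡ q hs))

  InJ-*ˡ : ∀ q {p} → InJ p → InJ (q *ₚ p)
  InJ-*ˡ q (inJ hs p≈) = inJ (List.map (λ (h , g) → q *ₚ h , g) hs) (ℙ.trans (*ₚ-congˡ q p≈) (Jsum-*ˡ q hs))

  InJ-subspace : Subspace InJ
  InJ-subspace = record
    { resp = λ q≈r (inJ hs r≈) → inJ hs (ℙ.trans q≈r r≈)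
    ; []∈ = inJ [] ℙ.refl
    ; +-closed = λ (inJ hs q≈) (inJ hs′ r≈) → inJ (hs ++ hs′) (ℙ.trans (ℙ.+-cong q≈ r≈) (ℙ.sym (Jsum-++ hs hs′)))
    ; κ*-closed = λ s → InJ-*ˡ (κ s) }

  cover∈J : (g : Cover) → InJ (prodLines (Cover.lines g))
  cover∈J g = inJ ((1ₚ , g) ∷ []) (ℙ.sym (ℙ.trans (ℙ.+-identityʳ _) (ℙ.*-identityˡ _)))

  InJ-vanishes : ∀ {p} → InJ p → ∀ k → eval F p (pt k) ≈ 0#
  InJ-vanishes (inJ hs p≈) k = trans (eval-cong (pt k) p≈) (Jsum-vanishes hs)
    where
    Jsum-vanishes : ∀ hs → eval F (Jsum hs) (pt k) ≈ 0#
    Jsum-vanishes [] = refl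
    Jsum-vanishes ((h , g) ∷ hs) = trans (eval-+ (h *ₚ prodLines ls) (Jsum hs) (pt k)) (trans (+-cong
      (trans (eval-* h (prodLines ls) (pt k)) (trans (*-congˡ (prodLines-vanishes ls (Cover.covers g k))) (zeroʳ _))) (Jsum-vanishes hs)) (+-identityʳ 0#))
      where ls = Cover.lines g

  -- for each point f, three lines through the other five points, chosen to keep the derivation in Cubics short
  QTriple : Fin 6 → Pair × Pair × Pair
  QTriple 0F = (1F , 3F) , (2F , 4F) , (3F , 5F)
  QTriple 1F = (0F , 3F) , (2F , 4F) , (4F , 5F)
  QTriple 2F = (0F , 3F) , (1F , 4F) , (4F , 5F)
  QTriple 3F = (0F , 1F) , (0F , 5F) , (2F , 4F)
  QTriple 4F = (0F , 2F) , (1F , 3F) , (2F , 5F)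
  QTriple 5F = (0F , 3F) , (1F , 4F) , (2F , 4F)

  Qlines : Fin 6 → List Pair
  Qlines f = let (a , b , c) = QTriple f in a ∷ b ∷ c ∷ []

  apex : Fin 6 → Pair
  apex f = proj₁ (QTriple f)

  record QLines (f : Fin 6) : Set where
    field
      proper : All Proper (Qlines f)
      avoids : All (λ l → ¬ f ∈ₗ l) (Qlines f)
      covers : ∀ k → k ≢ f → Any (k ∈ₗ_) (Qlines f)

  qLines : ∀ f → QLines f
  qLines f = record { proper = proper ; avoids = avoids ; covers = covers }
    where
    checks : ∀ f → All Proper (Qlines f) × All (λ l → ¬ f ∈ₗ l) (Qlines f) × (∀ k → k ≢ f → Any (k ∈ₗ_) (Qlines f))
    checks = toWitness {a? = Fin.all? λ f → All.all? Proper? (Qlines f) ×-dec All.all? (λ l → ¬? (f ∈ₗ? l)) (Qlines f)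
                                           ×-dec Fin.all? (λ k → ¬? (k Fin.≟ f) →-dec Any.any? (k ∈ₗ?_) (Qlines f))} _
    proper = proj₁ (checks f)
    avoids = proj₁ (proj₂ (checks f))
    covers = proj₂ (proj₂ (checks f))

  Q : ℕ → Fin 6 → Poly F
  Q n f = prodLines (replicate n (apex f) ++ Qlines f)

  Q-vanishes : ∀ n f k → k ≢ f → eval F (Q n f) (pt k) ≈ 0#
  Q-vanishes n f k k≢f = prodLines-vanishes _ (Any.++⁺ʳ (replicate n (apex f)) (QLines.covers (qLines f) k k≢f))

  replicate-All : ∀ {p} {P : Pair → Set p} n {l} → P l → All P (replicate n l)
  replicate-All zero _ = []
  replicate-All (suc n) Pl = Pl ∷ replicate-All n Pl

  Q-proper : ∀ n f → All Proper (replicate n (apex f) ++ Qlines f)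
  Q-proper n f = All.++⁺ (replicate-All n (All.head proper)) proper
    where open QLines (qLines f)

  Q-nonvanishing : ∀ n f → ¬ eval F (Q n f) (pt f) ≈ 0#
  Q-nonvanishing n f = prodLines-nonvanishing (Q-proper n f) (All.++⁺ (replicate-All n (All.head avoids)) avoids)
    where open QLines (qLines f)

  line·Q∈J : ∀ n f l → Proper l → f ∈ₗ l → InJ (line l *ₚ Q n f)
  line·Q∈J n f l l-proper f∈l = cover∈J record
    { lines = l ∷ replicate n (apex f) ++ Qlines f
    ; proper = l-proper ∷ Q-proper n f
    ; covers = λ k → case k Fin.≟ f of λ where
        (yes ≡.refl) → here f∈l
        (no k≢f)     → there (Any.++⁺ʳ (replicate n (apex f)) (QLines.covers (qLines f) k k≢f)) }

  Red : ℕ → Poly F → Set (c ⊔ ℓ)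
  Red n = InJ ⊞ Span (Q n)

  Red-subspace : ∀ n → Subspace (Red n)
  Red-subspace n = ⊞-subspace InJ-subspace (Span-subspace (Q n))

  InJ⊆Red : ∀ n {p} → InJ p → Red n p
  InJ⊆Red n {p} p∈J = ⊞-intro p∈J (Subspace.[]∈ (Span-subspace (Q n))) (ℙ.sym (ℙ.+-identityʳ p))

  Q∈Red : ∀ n f → Red n (Q n f)
  Q∈Red n f = ⊞-intro (Subspace.[]∈ InJ-subspace) (Span-element (Q n) f) (ℙ.sym (ℙ.+-identityˡ (Q n f)))

  lin·Q∈Red : ∀ n f w → Red (suc n) (lin w *ₚ Q n f)
  lin·Q∈Red n f w = resp expand (+-closed (+-closed
    (κ*-closed α (Q∈Red (suc n) f))
    (κ*-closed β (InJ⊆Red (suc n) (line·Q∈J n f (b , f) (λ b≡f → f∉ab (inj₂ (≡.sym b≡f))) (inj₂ ≡.refl)))))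
    (κ*-closed γ (InJ⊆Red (suc n) (line·Q∈J n f (f , a) (λ f≡a → f∉ab (inj₁ f≡a)) (inj₁ ≡.refl)))))
    where
    open Subspace (Red-subspace (suc n))
    open ℙ-Solver using (solve; _:=_; _:+_; _:*_)
    a = proj₁ (apex f)
    b = proj₂ (apex f)
    a≢b : a ≢ b
    a≢b = All.head (QLines.proper (qLines f))
    f∉ab : ¬ f ∈ₗ apex f
    f∉ab = All.head (QLines.avoids (qLines f))
    triangle = lin-in-triangle (λ f≡a → f∉ab (inj₁ f≡a)) a≢b (λ f≡b → f∉ab (inj₂ f≡b)) w
    α = proj₁ (proj₁ triangle)
    β = proj₁ (proj₂ (proj₁ triangle))
    γ = proj₂ (proj₂ (proj₁ triangle))
    expand : lin w *ₚ Q n f ≈ₚ κ α *ₚ Q (suc n) f +ₚ κ β *ₚ (line (b , f) *ₚ Q n f) +ₚ κ γ *ₚ (line (f , a) *ₚ Q n f)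
    expand = ℙ.trans (*ₚ-congʳ (Q n f) (proj₁ (proj₂ triangle)))
      (solve 7 (λ α β γ l₁ l₂ l₃ q → (α :* l₁ :+ β :* l₂ :+ γ :* l₃) :* q := α :* (l₁ :* q) :+ β :* (l₂ :* q) :+ γ :* (l₃ :* q))
        ℙ.refl (κ α) (κ β) (κ γ) (line (a , b)) (line (b , f)) (line (f , a)) (Q n f))

  Red-step : ∀ n w {p} → Red n p → Red (suc n) (lin w *ₚ p)
  Red-step n w (⊞-intro {j} {s} j∈J s∈span p≈) = resp (ℙ.trans (*ₚ-congˡ (lin w) p≈) (ℙ.distribˡ (lin w) j s))
    (+-closed (InJ⊆Red (suc n) (InJ-*ˡ (lin w) j∈J)) (Span-*ˡ (Red-subspace (suc n)) (lin w) (λ f → lin·Q∈Red n f w) s∈span))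
    where open Subspace (Red-subspace (suc n))

  prodLines-ofDegree : ∀ ls → OfDegree (List.length ls) (prodLines ls)
  prodLines-ofDegree [] = ≡.refl ∷ []
  prodLines-ofDegree (l ∷ ls) = OfDegree-* (lin-ofDegree _) (prodLines-ofDegree ls)

  lineForms : ∀ ls → All Proper ls → List (LinearForm F)
  lineForms [] [] = []
  lineForms (l ∷ ls) (l-proper ∷ proper) = lineForm l-proper ∷ lineForms ls proper

  prodLines≡ : ∀ ls proper → prodLines ls ≡ foldr (λ L h → linPoly F L *ₚ h) 1ₚ (lineForms ls proper)
  prodLines≡ [] [] = ≡.refl
  prodLines≡ (l ∷ ls) (_ ∷ proper) = ≡.cong (line l *ₚ_) (prodLines≡ ls proper)

  cover-prodLin : (g : Cover) → Points.ProdLin F A (prodLines (Cover.lines g))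
  cover-prodLin g = lineForms _ (Cover.proper g) , at (≡⇒≈ₚ (prodLines≡ _ (Cover.proper g)))

  cover-InI : (g : Cover) → Points.InI F A (prodLines (Cover.lines g))
  cover-InI g k = ofDegree-vanishesAt (prodLines-ofDegree (Cover.lines g)) (A k) (prodLines-vanishes _ (Cover.covers g k))

  ≈[]⇒InJ : ∀ {p} → p ≈ₚ [] → InJ p
  ≈[]⇒InJ p≈[] = Subspace.resp InJ-subspace p≈[] (Subspace.[]∈ InJ-subspace)

  vanishing-Red⇒InJ : ∀ n {p} → Red n p → (∀ k → eval F p (pt k) ≈ 0#) → InJ p
  vanishing-Red⇒InJ n {p} (⊞-intro {j} {s} j∈J s∈span p≈) p-vanishes =
    Subspace.resp InJ-subspace (ℙ.trans p≈ (ℙ.trans (ℙ.+-cong ℙ.refl s≈[]) (ℙ.+-identityʳ j))) j∈J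
    where
    s-vanishes : ∀ f → eval F s (pt f) ≈ 0#
    s-vanishes f = begin
      eval F s (pt f)                    ≈⟨ sym (+-identityˡ _) ⟩
      0# + eval F s (pt f)               ≈⟨ +-congʳ (sym (InJ-vanishes j∈J f)) ⟩
      eval F j (pt f) + eval F s (pt f)  ≈⟨ sym (eval-+ j s (pt f)) ⟩
      eval F (j +ₚ s) (pt f)             ≈⟨ sym (eval-cong (pt f) p≈) ⟩
      eval F p (pt f)                    ≈⟨ p-vanishes f ⟩
      0#                                 ∎
      where open ≈-Reasoning setoid
    s≈[] : s ≈ₚ []
    s≈[] = dual-points⇒≈[] (Q n) pt (Q-nonvanishing n) (λ f k k≢f → Q-vanishes n k f (λ f≡k → k≢f (≡.sym f≡k))) s∈span s-vanishes

  -- certified and Jsum≡foldr are stated for an arbitrary predicate and step function, since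
  -- those in GeneratedByProdLin are pattern lambdas that cannot be named here
  J⇒GeneratedByProdLin : (∀ f → Points.InI F A f → InJ f) → Points.GeneratedByProdLin F A
  J⇒GeneratedByProdLin I⊆J f f∈I =
    List.map term hs , certified _ (λ _ _ certificate → certificate) hs ,
    λ e → trans (at f≈ e) (reflexive (≡.cong (λ p → coeff F p e) (Jsum≡foldr _ (λ _ _ _ → ≡.refl) hs)))
    where
    hs = InJ.terms (I⊆J f f∈I)
    f≈ = InJ.≈Jsum (I⊆J f f∈I)
    term : Poly F × Cover → Poly F × Poly F
    term (h , g) = h , prodLines (Cover.lines g)
    certified : ∀ {p} (P : Poly F × Poly F → Set p) →
                (∀ h (g : Cover) → Points.ProdLin F A (prodLines (Cover.lines g)) × Points.InI F A (prodLines (Cover.lines g)) → P (term (h , g))) →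
                ∀ hs → All P (List.map term hs)
    certified P ok [] = []
    certified P ok ((h , g) ∷ hs) = ok h g (cover-prodLin g , cover-InI g) ∷ certified P ok hs
    Jsum≡foldr : ∀ (φ : Poly F × Poly F → Poly F → Poly F) → (∀ h g acc → φ (h , g) acc ≡ h *ₚ g +ₚ acc) →
                 ∀ hs → Jsum hs ≡ foldr φ [] (List.map term hs)
    Jsum≡foldr φ φ≡ [] = ≡.refl
    Jsum≡foldr φ φ≡ ((h , g) ∷ hs) = ≡.trans (≡.cong (h *ₚ prodLines (Cover.lines g) +ₚ_) (Jsum≡foldr φ φ≡ hs)) (≡.sym (φ≡ h _ _))

module CubicDerivation {c ℓ : Level} (F : Field c ℓ) (A : Fin 6 → Point F)
  (distinct : Points.Distinct F A) (general : Points.LinearlyGeneral F A) where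

  open Field F hiding (zero)
  open Polynomials F
  open Vectors F
  open LinearForms F
  open Subspaces F
  open Configuration F A distinct general
  open Reduction F A distinct general

  record R₃ (X Y Z : Poly F) : Set (c ⊔ ℓ) where
    constructor r₃
    field red : Red 0 (X *ₚ (Y *ₚ (Z *ₚ 1ₚ)))

  module _ where
    open Subspace (Red-subspace 0)
    open ℙ-Solver using (solve; _:=_; _:*_; con)

    R₃-swap₁₂ : ∀ {X Y Z} → R₃ X Y Z → R₃ Y X Z
    R₃-swap₁₂ {X} {Y} {Z} (r₃ r) = r₃ (resp (solve 3 (λ x y z → y :* (x :* (z :* con (1 , 0))) := x :* (y :* (z :* con (1 , 0)))) ℙ.refl X Y Z) r)

    R₃-swap₂₃ : ∀ {X Y Z} → R₃ X Y Z → R₃ X Z Y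
    R₃-swap₂₃ {X} {Y} {Z} (r₃ r) = r₃ (resp (solve 3 (λ x y z → x :* (z :* (y :* con (1 , 0))) := x :* (y :* (z :* con (1 , 0)))) ℙ.refl X Y Z) r)

    R₃-κ : ∀ {X Y Z} s → R₃ X Y Z → R₃ (κ s *ₚ X) Y Z
    R₃-κ {X} {Y} {Z} s (r₃ r) = r₃ (resp (ℙ.*-assoc (κ s) X (Y *ₚ (Z *ₚ 1ₚ))) (κ*-closed s r))

    R₃-resp : ∀ {X X′ Y Z} → X ≈ₚ X′ → R₃ X′ Y Z → R₃ X Y Z
    R₃-resp {Y = Y} {Z} X≈X′ (r₃ r) = r₃ (resp (*ₚ-congʳ (Y *ₚ (Z *ₚ 1ₚ)) X≈X′) r)

    R₃-+ : ∀ {X X′ Y Z} → R₃ X Y Z → R₃ X′ Y Z → R₃ (X +ₚ X′) Y Z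
    R₃-+ {X} {X′} {Y} {Z} (r₃ r) (r₃ r′) = r₃ (resp (ℙ.distribʳ (Y *ₚ (Z *ₚ 1ₚ)) X X′) (+-closed r r′))

    R₃-[] : ∀ {Y Z} → R₃ [] Y Z
    R₃-[] = r₃ []∈

  R₃-flip : ∀ {i j Y Z} → R₃ (line (i , j)) Y Z → R₃ (line (j , i)) Y Z
  R₃-flip {i} {j} r = R₃-resp (ℙ.trans (lin-cong (cross-antisym (pt i) (pt j))) (ℙ.sym (κ-lin (- 1#) (cross (pt i) (pt j))))) (R₃-κ (- 1#) r)

  R₃-expand : ∀ {i j k Y Z} → i ≢ j → j ≢ k → i ≢ k →
              R₃ (line (j , k)) Y Z → R₃ (line (k , i)) Y Z → R₃ (line (i , j)) Y Z → ∀ w → R₃ (lin w) Y Z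
  R₃-expand i≢j j≢k i≢k r₁ r₂ r₃′ w = R₃-resp (proj₁ (proj₂ triangle)) (R₃-+ (R₃-+ (R₃-κ α r₁) (R₃-κ β r₂)) (R₃-κ γ r₃′))
    where
    triangle = lin-in-triangle i≢j j≢k i≢k w
    α = proj₁ (proj₁ triangle)
    β = proj₁ (proj₂ (proj₁ triangle))
    γ = proj₂ (proj₂ (proj₁ triangle))

  -- a line through point i only needs the two sides of the triangle at i
  R₃-pencil : ∀ {i j k Y Z} → i ≢ j → j ≢ k → i ≢ k →
              R₃ (line (k , i)) Y Z → R₃ (line (i , j)) Y Z → ∀ x → R₃ (line (x , i)) Y Z
  R₃-pencil {i} {j} {k} i≢j j≢k i≢k r₂ r₃′ x =
    R₃-resp (proj₁ (proj₂ triangle)) (R₃-+ (R₃-+ (R₃-resp vanishing R₃-[]) (R₃-κ β r₂)) (R₃-κ γ r₃′))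
    where
    triangle = lin-in-triangle i≢j j≢k i≢k (cross (pt x) (pt i))
    α = proj₁ (proj₁ triangle)
    β = proj₁ (proj₂ (proj₁ triangle))
    γ = proj₂ (proj₂ (proj₁ triangle))
    vanishing : κ α *ₚ line (j , k) ≈ₚ []
    vanishing = ℙ.trans (*ₚ-congʳ (line (j , k)) (ℙ.trans (κ-cong (proj₂ (proj₂ triangle) (cross-·ʳ (pt x) (pt i)))) κ-0)) (ℙ.zeroˡ (line (j , k)))

  -- Products of three lines are compared as unordered triples of unordered pairs, through a normal form.
  normPair : Pair → Pair
  normPair (i , j) = if Fin.toℕ j ℕ.<ᵇ Fin.toℕ i then (j , i) else (i , j)

  _≤ᴾ_ : Pair → Pair → Bool
  (i , j) ≤ᴾ (i′ , j′) = Fin.toℕ i ℕ.* 6 ℕ.+ Fin.toℕ j ℕ.≤ᵇ Fin.toℕ i′ ℕ.* 6 ℕ.+ Fin.toℕ j′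

  sort₃ : Pair → Pair → Pair → Pair × Pair × Pair
  sort₃ a b c = if a ≤ᴾ b
    then (if b ≤ᴾ c then (a , b , c) else if a ≤ᴾ c then (a , c , b) else (c , a , b))
    else (if a ≤ᴾ c then (b , a , c) else if b ≤ᴾ c then (b , c , a) else (c , b , a))

  module Sorting {p} (P : Pair → Pair → Pair → Set p)
    (swap₁₂ : ∀ {a b c} → P a b c → P b a c) (swap₂₃ : ∀ {a b c} → P a b c → P a c b) where

    P₃ : Pair × Pair × Pair → Set p
    P₃ (a , b , c) = P a b c

    to-sorted : ∀ a b c → P a b c → P₃ (sort₃ a b c)
    to-sorted a b c r with a ≤ᴾ b | b ≤ᴾ c | a ≤ᴾ c
    ... | true  | true  | _     = r
    ... | true  | false | true  = swap₂₃ r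
    ... | true  | false | false = swap₁₂ (swap₂₃ r)
    ... | false | _     | true  = swap₁₂ r
    ... | false | true  | false = swap₂₃ (swap₁₂ r)
    ... | false | false | false = swap₁₂ (swap₂₃ (swap₁₂ r))

    from-sorted : ∀ a b c → P₃ (sort₃ a b c) → P a b c
    from-sorted a b c r with a ≤ᴾ b | b ≤ᴾ c | a ≤ᴾ c
    ... | true  | true  | _     = r
    ... | true  | false | true  = swap₂₃ r
    ... | true  | false | false = swap₂₃ (swap₁₂ r)
    ... | false | _     | true  = swap₁₂ r
    ... | false | true  | false = swap₁₂ (swap₂₃ r)
    ... | false | false | false = swap₁₂ (swap₂₃ (swap₁₂ r))

  R₃-normPair : ∀ a {Y Z} → R₃ (line a) Y Z → R₃ (line (normPair a)) Y Z
  R₃-normPair (i , j) r with Fin.toℕ j ℕ.<ᵇ Fin.toℕ i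
  ... | true  = R₃-flip r
  ... | false = r

  R₃-unnormPair : ∀ a {Y Z} → R₃ (line (normPair a)) Y Z → R₃ (line a) Y Z
  R₃-unnormPair (i , j) r with Fin.toℕ j ℕ.<ᵇ Fin.toℕ i
  ... | true  = R₃-flip r
  ... | false = r

  Lines₃ : Pair → Pair → Pair → Set (c ⊔ ℓ)
  Lines₃ a b c = R₃ (line a) (line b) (line c)

  -- definitionally insensitive to the order of the lines and of the points on each line
  Red₃ : Pair → Pair → Pair → Set (c ⊔ ℓ)
  Red₃ a b c = Sorting.P₃ Lines₃ R₃-swap₁₂ R₃-swap₂₃ (sort₃ (normPair a) (normPair b) (normPair c))

  Red₃⇒Lines₃ : ∀ a b c → Red₃ a b c → Lines₃ a b c
  Red₃⇒Lines₃ a b c r =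
    R₃-swap₂₃ (R₃-swap₁₂ (R₃-unnormPair c (R₃-swap₁₂ (R₃-swap₂₃ (R₃-swap₁₂ (R₃-unnormPair b (R₃-swap₁₂ (R₃-unnormPair a
      (Sorting.from-sorted Lines₃ R₃-swap₁₂ R₃-swap₂₃ (normPair a) (normPair b) (normPair c) r)))))))))

  Lines₃⇒Red₃ : ∀ a b c → Lines₃ a b c → Red₃ a b c
  Lines₃⇒Red₃ a b c r =
    Sorting.to-sorted Lines₃ R₃-swap₁₂ R₃-swap₂₃ (normPair a) (normPair b) (normPair c)
      (R₃-swap₂₃ (R₃-swap₁₂ (R₃-normPair c (R₃-swap₁₂ (R₃-swap₂₃ (R₃-swap₁₂ (R₃-normPair b (R₃-swap₁₂ (R₃-normPair a r)))))))))

  Distinct₃ : Fin 6 → Fin 6 → Fin 6 → Set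
  Distinct₃ i j k = i ≢ j × j ≢ k × i ≢ k

  distinct₃? : ∀ i j k → Dec (Distinct₃ i j k)
  distinct₃? i j k = ¬? (i Fin.≟ j) ×-dec ¬? (j Fin.≟ k) ×-dec ¬? (i Fin.≟ k)

  cover? : ∀ ls → Dec (All Proper ls × (∀ k → Any (k ∈ₗ_) ls))
  cover? ls = All.all? Proper? ls ×-dec Fin.all? (λ k → Any.any? (k ∈ₗ?_) ls)

  -- the side conditions of the rules below are decided by evaluation

  expand : ∀ i j k {d : True (distinct₃? i j k)} {Y Z} →
           R₃ (line (i , j)) Y Z → R₃ (line (i , k)) Y Z → R₃ (line (j , k)) Y Z → ∀ w → R₃ (lin w) Y Z
  expand i j k {d} r₁ r₂ r₃′ = let (i≢j , j≢k , i≢k) = toWitness d in R₃-expand i≢j j≢k i≢k r₃′ (R₃-flip r₂) r₁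

  expand-lines : ∀ l m i j k {d : True (distinct₃? i j k)} →
                 Red₃ (i , j) l m → Red₃ (i , k) l m → Red₃ (j , k) l m → ∀ w → R₃ (lin w) (line l) (line m)
  expand-lines l m i j k {d} r₁ r₂ r₃′ =
    expand i j k {d} (Red₃⇒Lines₃ (i , j) l m r₁) (Red₃⇒Lines₃ (i , k) l m r₂) (Red₃⇒Lines₃ (j , k) l m r₃′)

  pencil : ∀ (l : Pair) j k b c {d : True (distinct₃? (proj₂ l) j k)} →
           Red₃ (proj₂ l , j) b c → Red₃ (proj₂ l , k) b c → Red₃ l b c
  pencil (x , i) j k b c {d} r₁ r₂ = let (i≢j , j≢k , i≢k) = toWitness d in Lines₃⇒Red₃ (x , i) b c
    (R₃-pencil i≢j j≢k i≢k (R₃-flip (Red₃⇒Lines₃ (i , k) b c r₂)) (Red₃⇒Lines₃ (i , j) b c r₁) x)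

  byJ : ∀ a b c {cov : True (cover? (a ∷ b ∷ c ∷ []))} → Red₃ a b c
  byJ a b c {cov} = Lines₃⇒Red₃ a b c (r₃ (InJ⊆Red 0 (cover∈J record
    { lines = a ∷ b ∷ c ∷ [] ; proper = proj₁ (toWitness cov) ; covers = proj₂ (toWitness cov) })))

  byQ : ∀ f → let (a , b , c) = QTriple f in Red₃ a b c
  byQ f = Lines₃⇒Red₃ _ _ _ (r₃ (Q∈Red 0 f))

  rotate : ∀ {X Y Z} → R₃ X Y Z → R₃ Z X Y
  rotate r = R₃-swap₁₂ (R₃-swap₂₃ r)

  -- The factors of a product of three linear forms are expanded in turn along triangles of the
  -- points; the resulting products of three lines reduce along pencils to covers and to the Q f.
  module Cubics where

    L01·L03·L24 : Red₃ (0F , 1F) (0F , 3F) (2F , 4F)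
    L01·L03·L24 = pencil (0F , 1F) 4F 5F (0F , 3F) (2F , 4F) (byQ 5F) (byJ (0F , 3F) (1F , 5F) (2F , 4F))

    L01·L13·L25 : Red₃ (0F , 1F) (1F , 3F) (2F , 5F)
    L01·L13·L25 = pencil (1F , 0F) 2F 4F (1F , 3F) (2F , 5F) (byQ 4F) (byJ (0F , 4F) (1F , 3F) (2F , 5F))

    L01·L24·L25 : Red₃ (0F , 1F) (2F , 4F) (2F , 5F)
    L01·L24·L25 = pencil (2F , 5F) 0F 3F (0F , 1F) (2F , 4F) (byQ 3F) (byJ (0F , 1F) (2F , 4F) (3F , 5F))

    L01·L14·L25 : Red₃ (0F , 1F) (1F , 4F) (2F , 5F)
    L01·L14·L25 = pencil (1F , 4F) 2F 3F (0F , 1F) (2F , 5F) L01·L24·L25 (byJ (0F , 1F) (2F , 5F) (3F , 4F))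

    L01·L24·L45 : Red₃ (0F , 1F) (2F , 4F) (4F , 5F)
    L01·L24·L45 = pencil (4F , 5F) 0F 3F (0F , 1F) (2F , 4F) (byQ 3F) (byJ (0F , 1F) (2F , 4F) (3F , 5F))

    L01·L02·L45 : Red₃ (0F , 1F) (0F , 2F) (4F , 5F)
    L01·L02·L45 = pencil (0F , 2F) 3F 4F (0F , 1F) (4F , 5F) (byJ (0F , 1F) (2F , 3F) (4F , 5F)) L01·L24·L45

    L01·L03·L45 : Red₃ (0F , 1F) (0F , 3F) (4F , 5F)
    L01·L03·L45 = pencil (0F , 1F) 2F 4F (0F , 3F) (4F , 5F) (byJ (0F , 3F) (1F , 2F) (4F , 5F)) (byQ 2F)

    L03·L12·L24 : Red₃ (0F , 3F) (1F , 2F) (2F , 4F)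
    L03·L12·L24 = pencil (2F , 1F) 4F 5F (0F , 3F) (2F , 4F) (byQ 5F) (byJ (0F , 3F) (1F , 5F) (2F , 4F))

    L03·L13·L25 : Red₃ (0F , 3F) (1F , 3F) (2F , 5F)
    L03·L13·L25 = pencil (3F , 0F) 2F 4F (1F , 3F) (2F , 5F) (byQ 4F) (byJ (0F , 4F) (1F , 3F) (2F , 5F))

    L03·L12·L25 : Red₃ (0F , 3F) (1F , 2F) (2F , 5F)
    L03·L12·L25 = pencil (2F , 1F) 3F 4F (0F , 3F) (2F , 5F) L03·L13·L25 (byJ (0F , 3F) (1F , 4F) (2F , 5F))

    L03·L13·L24 : Red₃ (0F , 3F) (1F , 3F) (2F , 4F)
    L03·L13·L24 = pencil (3F , 1F) 4F 5F (0F , 3F) (2F , 4F) (byQ 5F) (byJ (0F , 3F) (1F , 5F) (2F , 4F))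

    L13·L24·L25 : Red₃ (1F , 3F) (2F , 4F) (2F , 5F)
    L13·L24·L25 = pencil (2F , 5F) 0F 3F (1F , 3F) (2F , 4F) (byJ (0F , 5F) (1F , 3F) (2F , 4F)) (byQ 0F)

    L03·L13·L45 : Red₃ (0F , 3F) (1F , 3F) (4F , 5F)
    L03·L13·L45 = pencil (3F , 1F) 2F 4F (0F , 3F) (4F , 5F) (byJ (0F , 3F) (1F , 2F) (4F , 5F)) (byQ 2F)

    L13·L24·L45 : Red₃ (1F , 3F) (2F , 4F) (4F , 5F)
    L13·L24·L45 = pencil (4F , 5F) 0F 3F (1F , 3F) (2F , 4F) (byJ (0F , 5F) (1F , 3F) (2F , 4F)) (byQ 0F)

    L13·L23·L45 : Red₃ (1F , 3F) (2F , 3F) (4F , 5F)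
    L13·L23·L45 = pencil (3F , 2F) 0F 4F (1F , 3F) (4F , 5F) (byJ (0F , 2F) (1F , 3F) (4F , 5F)) L13·L24·L45

    L01·L24·w : ∀ w → R₃ (lin w) (line (0F , 1F)) (line (2F , 4F))
    L01·L24·w = expand-lines (0F , 1F) (2F , 4F) 0F 3F 5F L01·L03·L24 (byQ 3F) (byJ (0F , 1F) (2F , 4F) (3F , 5F))

    L01·L25·w : ∀ w → R₃ (lin w) (line (0F , 1F)) (line (2F , 5F))
    L01·L25·w = expand-lines (0F , 1F) (2F , 5F) 1F 3F 4F L01·L13·L25 L01·L14·L25 (byJ (0F , 1F) (2F , 5F) (3F , 4F))

    L01·L45·w : ∀ w → R₃ (lin w) (line (0F , 1F)) (line (4F , 5F))
    L01·L45·w = expand-lines (0F , 1F) (4F , 5F) 0F 2F 3F L01·L02·L45 L01·L03·L45 (byJ (0F , 1F) (2F , 3F) (4F , 5F))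

    L03·L12·w : ∀ w → R₃ (lin w) (line (0F , 3F)) (line (1F , 2F))
    L03·L12·w = expand-lines (0F , 3F) (1F , 2F) 2F 4F 5F L03·L12·L24 L03·L12·L25 (byJ (0F , 3F) (1F , 2F) (4F , 5F))

    L03·L14·w : ∀ w → R₃ (lin w) (line (0F , 3F)) (line (1F , 4F))
    L03·L14·w = expand-lines (0F , 3F) (1F , 4F) 2F 4F 5F (byQ 5F) (byJ (0F , 3F) (1F , 4F) (2F , 5F)) (byQ 2F)

    L03·L24·w : ∀ w → R₃ (lin w) (line (0F , 3F)) (line (2F , 4F))
    L03·L24·w = expand-lines (0F , 3F) (2F , 4F) 1F 4F 5F (byQ 5F) (byJ (0F , 3F) (1F , 5F) (2F , 4F)) (byQ 1F)

    L13·L24·w : ∀ w → R₃ (lin w) (line (1F , 3F)) (line (2F , 4F))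
    L13·L24·w = expand-lines (1F , 3F) (2F , 4F) 0F 3F 5F L03·L13·L24 (byJ (0F , 5F) (1F , 3F) (2F , 4F)) (byQ 0F)

    L13·L25·w : ∀ w → R₃ (lin w) (line (1F , 3F)) (line (2F , 5F))
    L13·L25·w = expand-lines (1F , 3F) (2F , 5F) 0F 2F 4F (byQ 4F) (byJ (0F , 4F) (1F , 3F) (2F , 5F)) L13·L24·L25

    L13·L45·w : ∀ w → R₃ (lin w) (line (1F , 3F)) (line (4F , 5F))
    L13·L45·w = expand-lines (1F , 3F) (4F , 5F) 0F 2F 3F (byJ (0F , 2F) (1F , 3F) (4F , 5F)) L03·L13·L45 L13·L23·L45

    L01·v·w : ∀ v w → R₃ (lin v) (lin w) (line (0F , 1F))
    L01·v·w v w = expand 2F 4F 5F (rotate (L01·L24·w w)) (rotate (L01·L25·w w)) (rotate (L01·L45·w w)) v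

    L03·v·w : ∀ v w → R₃ (lin v) (lin w) (line (0F , 3F))
    L03·v·w v w = expand 1F 2F 4F (rotate (L03·L12·w w)) (rotate (L03·L14·w w)) (rotate (L03·L24·w w)) v

    L13·v·w : ∀ v w → R₃ (lin v) (lin w) (line (1F , 3F))
    L13·v·w v w = expand 2F 4F 5F (rotate (L13·L24·w w)) (rotate (L13·L25·w w)) (rotate (L13·L45·w w)) v

    u·v·w : ∀ u v w → R₃ (lin u) (lin v) (lin w)
    u·v·w u v w = expand 0F 1F 3F (rotate (L01·v·w v w)) (rotate (L03·v·w v w)) (rotate (L13·v·w v w)) u

  cubic∈Red : ∀ u v w → Red 0 (prodLin (u ∷ v ∷ w ∷ []))
  cubic∈Red u v w = R₃.red (Cubics.u·v·w u v w)

module LowDegree {c ℓ : Level} (F : Field c ℓ) (A : Fin 6 → Point F)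
  (distinct : Points.Distinct F A) (general : Points.LinearlyGeneral F A) where

  open Field F hiding (zero)
  open Polynomials F
  open FieldProperties F
  open Vectors F
  open LinearForms F
  open Subspaces F
  open Configuration F A distinct general
  open IntegerCoefficients commutativeRing using (solve; _:=_; _:+_; _:*_; _:-_; con)

  -- the sides of the triangle of the points 0, 1, 2; side i misses only vertex i
  vertex : Fin 3 → Fin 6
  vertex 0F = 0F
  vertex 1F = 1F
  vertex 2F = 2F

  side : Fin 3 → Poly F
  side 0F = line (1F , 2F)
  side 1F = line (2F , 0F)
  side 2F = line (0F , 1F)

  side-nonvanishing : ∀ i → ¬ eval F (side i) (pt (vertex i)) ≈ 0#
  side-nonvanishing 0F = line-nonvanishing (λ ()) (λ ()) (λ ())
  side-nonvanishing 1F = line-nonvanishing (λ ()) (λ ()) (λ ())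
  side-nonvanishing 2F = line-nonvanishing (λ ()) (λ ()) (λ ())

  side-vanishes : ∀ i j → j ≢ i → eval F (side j) (pt (vertex i)) ≈ 0#
  side-vanishes 0F 0F 0≢0 = ⊥-elim (0≢0 ≡.refl)
  side-vanishes 0F 1F _ = line-vanishes₂ 2F 0F
  side-vanishes 0F 2F _ = line-vanishes₁ 0F 1F
  side-vanishes 1F 0F _ = line-vanishes₁ 1F 2F
  side-vanishes 1F 1F 1≢1 = ⊥-elim (1≢1 ≡.refl)
  side-vanishes 1F 2F _ = line-vanishes₂ 0F 1F
  side-vanishes 2F 0F _ = line-vanishes₂ 1F 2F
  side-vanishes 2F 1F _ = line-vanishes₁ 2F 0F
  side-vanishes 2F 2F 2≢2 = ⊥-elim (2≢2 ≡.refl)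

  lin∈Span-side : ∀ v → Span side (lin v)
  lin∈Span-side v = resp (proj₁ (proj₂ triangle))
    (+-closed (+-closed (κ*-closed _ (Span-element side 0F)) (κ*-closed _ (Span-element side 1F))) (κ*-closed _ (Span-element side 2F)))
    where
    open Subspace (Span-subspace side)
    triangle = lin-in-triangle {0F} {1F} {2F} (λ ()) (λ ()) (λ ()) v

  one : Fin 1 → Poly F
  one _ = 1ₚ

  form₀≈[] : ∀ {p} → OfDegree 0 p → (∀ k → eval F p (pt k) ≈ 0#) → p ≈ₚ []
  form₀≈[] p-deg p-vanishes = dual-points⇒≈[] one (λ _ → pt 0F)
    (λ _ 1≈0 → 0≉1 (sym (trans (sym (eval-κ 1# (pt 0F))) 1≈0))) (λ { 0F 0F 0≢0 → ⊥-elim (0≢0 ≡.refl) })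
    (forms⊆ (Span-subspace one) 0 (λ { [] _ → Span-element one 0F }) p-deg) (λ _ → p-vanishes 0F)

  form₁≈[] : ∀ {p} → OfDegree 1 p → (∀ k → eval F p (pt k) ≈ 0#) → p ≈ₚ []
  form₁≈[] p-deg p-vanishes = dual-points⇒≈[] side (pt ∘ vertex) side-nonvanishing side-vanishes
    (forms⊆ (Span-subspace side) 1 (λ { (v ∷ []) _ → Subspace.resp (Span-subspace side) (ℙ.*-identityʳ (lin v)) (lin∈Span-side v) }) p-deg)
    (p-vanishes ∘ vertex)

  conic : Fin 6 → Poly F
  conic 0F = side 0F *ₚ side 0F
  conic 1F = side 1F *ₚ side 1F
  conic 2F = side 2F *ₚ side 2F
  conic 3F = side 0F *ₚ side 1F
  conic 4F = side 0F *ₚ side 2F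
  conic 5F = side 1F *ₚ side 2F

  conic-ofDegree : ∀ i → OfDegree 2 (conic i)
  conic-ofDegree 0F = OfDegree-* (lin-ofDegree _) (lin-ofDegree _)
  conic-ofDegree 1F = OfDegree-* (lin-ofDegree _) (lin-ofDegree _)
  conic-ofDegree 2F = OfDegree-* (lin-ofDegree _) (lin-ofDegree _)
  conic-ofDegree 3F = OfDegree-* (lin-ofDegree _) (lin-ofDegree _)
  conic-ofDegree 4F = OfDegree-* (lin-ofDegree _) (lin-ofDegree _)
  conic-ofDegree 5F = OfDegree-* (lin-ofDegree _) (lin-ofDegree _)

  side·side∈Span : ∀ i j → Span conic (side i *ₚ side j)
  side·side∈Span 0F 0F = Span-element conic 0F
  side·side∈Span 1F 1F = Span-element conic 1F
  side·side∈Span 2F 2F = Span-element conic 2F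
  side·side∈Span 0F 1F = Span-element conic 3F
  side·side∈Span 0F 2F = Span-element conic 4F
  side·side∈Span 1F 2F = Span-element conic 5F
  side·side∈Span 1F 0F = Subspace.resp (Span-subspace conic) (ℙ.*-comm (side 1F) (side 0F)) (Span-element conic 3F)
  side·side∈Span 2F 0F = Subspace.resp (Span-subspace conic) (ℙ.*-comm (side 2F) (side 0F)) (Span-element conic 4F)
  side·side∈Span 2F 1F = Subspace.resp (Span-subspace conic) (ℙ.*-comm (side 2F) (side 1F)) (Span-element conic 5F)

  quadric∈Span : ∀ {p} → OfDegree 2 p → Span conic p
  quadric∈Span = forms⊆ (Span-subspace conic) 2 λ where
    (u ∷ v ∷ []) _ → Subspace.resp (Span-subspace conic) (*ₚ-congˡ (lin u) (ℙ.*-identityʳ (lin v)))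
                       (Span-* (Span-subspace conic) side·side∈Span (lin∈Span-side u) (lin∈Span-side v))

  -- the value of combination d conic at a point where the sides take the values a, b, c
  quadratic : (Fin 6 → Carrier) → K³ → Carrier
  quadratic d (a , b , c) = d 0F * (a * a) + (d 1F * (b * b) + (d 2F * (c * c) + (d 3F * (a * b) + (d 4F * (a * c) + (d 5F * (b * c) + 0#)))))

  sides-at : K³ → K³
  sides-at v = eval F (side 0F) v , eval F (side 1F) v , eval F (side 2F) v

  eval-conics : ∀ d v → eval F (combination d conic) v ≈ quadratic d (sides-at v)
  eval-conics d v = trans (eval-combination≈sum d conic v)
    (+-cong (*-congˡ (eval-* (side 0F) (side 0F) v)) (+-cong (*-congˡ (eval-* (side 1F) (side 1F) v))
    (+-cong (*-congˡ (eval-* (side 2F) (side 2F) v)) (+-cong (*-congˡ (eval-* (side 0F) (side 1F) v))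
    (+-cong (*-congˡ (eval-* (side 0F) (side 2F) v)) (+-congʳ (*-congˡ (eval-* (side 1F) (side 2F) v))))))))

  quadratic-cong : ∀ d {a b c a′ b′ c′} → a ≈ a′ → b ≈ b′ → c ≈ c′ → quadratic d (a , b , c) ≈ quadratic d (a′ , b′ , c′)
  quadratic-cong d a≈ b≈ c≈ = +-cong (*-congˡ (*-cong a≈ a≈)) (+-cong (*-congˡ (*-cong b≈ b≈)) (+-cong (*-congˡ (*-cong c≈ c≈))
    (+-cong (*-congˡ (*-cong a≈ b≈)) (+-cong (*-congˡ (*-cong a≈ c≈)) (+-congʳ (*-congˡ (*-cong b≈ c≈)))))))

  quadratic-at-vertex : ∀ d i → let s = eval F (side i) (pt (vertex i)) in
                        quadratic d (sides-at (pt (vertex i))) ≈ d (i Fin.↑ˡ 3) * (s * s)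
  quadratic-at-vertex d 0F = trans (quadratic-cong d refl (side-vanishes 0F 1F (λ ())) (side-vanishes 0F 2F (λ ())))
    (solve 7 (λ d₀ d₁ d₂ d₃ d₄ d₅ a → d₀ :* (a :* a) :+ (d₁ :* (con (0 , 0) :* con (0 , 0)) :+ (d₂ :* (con (0 , 0) :* con (0 , 0))
      :+ (d₃ :* (a :* con (0 , 0)) :+ (d₄ :* (a :* con (0 , 0)) :+ (d₅ :* (con (0 , 0) :* con (0 , 0)) :+ con (0 , 0)))))) := d₀ :* (a :* a))
      refl (d 0F) (d 1F) (d 2F) (d 3F) (d 4F) (d 5F) _)
  quadratic-at-vertex d 1F = trans (quadratic-cong d (side-vanishes 1F 0F (λ ())) refl (side-vanishes 1F 2F (λ ())))
    (solve 7 (λ d₀ d₁ d₂ d₃ d₄ d₅ b → d₀ :* (con (0 , 0) :* con (0 , 0)) :+ (d₁ :* (b :* b) :+ (d₂ :* (con (0 , 0) :* con (0 , 0))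
      :+ (d₃ :* (con (0 , 0) :* b) :+ (d₄ :* (con (0 , 0) :* con (0 , 0)) :+ (d₅ :* (b :* con (0 , 0)) :+ con (0 , 0)))))) := d₁ :* (b :* b))
      refl (d 0F) (d 1F) (d 2F) (d 3F) (d 4F) (d 5F) _)
  quadratic-at-vertex d 2F = trans (quadratic-cong d (side-vanishes 2F 0F (λ ())) (side-vanishes 2F 1F (λ ())) refl)
    (solve 7 (λ d₀ d₁ d₂ d₃ d₄ d₅ c → d₀ :* (con (0 , 0) :* con (0 , 0)) :+ (d₁ :* (con (0 , 0) :* con (0 , 0)) :+ (d₂ :* (c :* c)
      :+ (d₃ :* (con (0 , 0) :* con (0 , 0)) :+ (d₄ :* (con (0 , 0) :* c) :+ (d₅ :* (con (0 , 0) :* c) :+ con (0 , 0)))))) := d₂ :* (c :* c))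
      refl (d 0F) (d 1F) (d 2F) (d 3F) (d 4F) (d 5F) _)

  mixed : K³ → K³
  mixed (a , b , c) = a * b , a * c , b * c

  mixed-cong : ∀ {a b c a′ b′ c′} → a ≈ a′ → b ≈ b′ → c ≈ c′ → mixed (a , b , c) ≈ᵥ mixed (a′ , b′ , c′)
  mixed-cong a≈ b≈ c≈ = *-cong a≈ b≈ , *-cong a≈ c≈ , *-cong b≈ c≈

  quadratic-mixed : ∀ d v → d 0F ≈ 0# → d 1F ≈ 0# → d 2F ≈ 0# → quadratic d v ≈ mixed v · (d 3F , d 4F , d 5F)
  quadratic-mixed d (a , b , c) d₀≈0 d₁≈0 d₂≈0 =
    trans (+-cong (*-congʳ d₀≈0) (+-cong (*-congʳ d₁≈0) (+-congʳ (*-congʳ d₂≈0))))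
      (solve 9 (λ a b c d₃ d₄ d₅ x y z →
                  con (0 , 0) :* x :+ (con (0 , 0) :* y :+ (con (0 , 0) :* z :+ (d₃ :* (a :* b) :+ (d₄ :* (a :* c) :+ (d₅ :* (b :* c) :+ con (0 , 0))))))
                                        := (a :* b) :* d₃ :+ (a :* c) :* d₄ :+ (b :* c) :* d₅)
        refl a b c (d 3F) (d 4F) (d 5F) (a * a) (b * b) (c * c))

  Δ : Carrier
  Δ = det (mixed (sides-at (pt 3F))) (mixed (sides-at (pt 4F))) (mixed (sides-at (pt 5F)))

  -- evaluating at the vertices kills the coefficients of the squares; the other three
  -- coefficients solve a linear system with determinant Δ
  form₂≈[] : ¬ Δ ≈ 0# → ∀ {p} → OfDegree 2 p → (∀ k → eval F p (pt k) ≈ 0#) → p ≈ₚ []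
  form₂≈[] Δ≉0 {p} p-deg p-vanishes = ℙ.trans p≈ (combination-≈0 d conic d≈0)
    where
    d = Span.coefficients (quadric∈Span p-deg)
    p≈ = Span.≈combination (quadric∈Span p-deg)
    value≈0 : ∀ k → quadratic d (sides-at (pt k)) ≈ 0#
    value≈0 k = trans (sym (eval-conics d (pt k))) (trans (sym (eval-cong (pt k) p≈)) (p-vanishes k))
    square-coefficient≈0 : ∀ i → d (i Fin.↑ˡ 3) ≈ 0#
    square-coefficient≈0 i = x*y≈0⇒y≈0 (*-nonzero (side-nonvanishing i) (side-nonvanishing i))
      (trans (*-comm _ _) (trans (sym (quadratic-at-vertex d i)) (value≈0 (vertex i))))
    x : K³
    x = d 3F , d 4F , d 5F
    orthogonal : ∀ k → x · mixed (sides-at (pt k)) ≈ 0#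
    orthogonal k = trans (·-comm x _) (trans (sym (quadratic-mixed d _ (square-coefficient≈0 0F) (square-coefficient≈0 1F) (square-coefficient≈0 2F)))
                                                 (value≈0 k))
    Δx≈0 : Δ ⊙ x ≈ᵥ (0# , 0# , 0#)
    Δx≈0 = ≈ᵥ-trans (cramer _ _ _ x) (⊙⊕-≈0 (orthogonal 3F) (orthogonal 4F) (orthogonal 5F))
    d≈0 : ∀ i → d i ≈ 0#
    d≈0 0F = square-coefficient≈0 0F
    d≈0 1F = square-coefficient≈0 1F
    d≈0 2F = square-coefficient≈0 2F
    d≈0 3F = x*y≈0⇒y≈0 Δ≉0 (proj₁ Δx≈0)
    d≈0 4F = x*y≈0⇒y≈0 Δ≉0 (proj₁ (proj₂ Δx≈0))
    d≈0 5F = x*y≈0⇒y≈0 Δ≉0 (proj₂ (proj₂ Δx≈0))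

  linComb≈combination : ∀ {r} (cs : Fin r → Carrier) fs → Points.linComb F A cs fs ≈ₚ combination cs fs
  linComb≈combination {zero} cs fs = ℙ.refl
  linComb≈combination {suc r} cs fs = ℙ.+-cong (ℙ.sym (κ-scale (cs 0F) (fs 0F))) (linComb≈combination (λ i → cs (fsuc i)) (λ i → fs (fsuc i)))

  -- If Δ vanished, there would be a nonzero conic through the six points, contradicting genericity.
  module _ (generic : Points.Generic F A) where
    open LinearDependence F using (Dependent; ¬¬-dependent)
    open import Algebra.Properties.CommutativeMonoid.Sum +-commutativeMonoid using (sum)

    R : Fin 6 → K³
    R k = mixed (sides-at (pt k))

    w : K³
    w = cross (R 3F) (R 4F)

    conic₀-coefficients : Fin 6 → Carrier
    conic₀-coefficients 3F = proj₁ w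
    conic₀-coefficients 4F = proj₁ (proj₂ w)
    conic₀-coefficients 5F = proj₂ (proj₂ w)
    conic₀-coefficients _  = 0#

    conic₀ : Poly F
    conic₀ = combination conic₀-coefficients conic

    eval-conic₀ : ∀ v → eval F conic₀ v ≈ w · mixed (sides-at v)
    eval-conic₀ v = trans (eval-conics conic₀-coefficients v)
      (trans (quadratic-mixed conic₀-coefficients (sides-at v) refl refl refl) (·-comm (mixed (sides-at v)) w))

    conic₀-vanishes : Δ ≈ 0# → ∀ k → eval F conic₀ (pt k) ≈ 0#
    conic₀-vanishes _ 0F = trans (eval-conics conic₀-coefficients (pt 0F)) (trans (quadratic-at-vertex conic₀-coefficients 0F) (zeroˡ _))
    conic₀-vanishes _ 1F = trans (eval-conics conic₀-coefficients (pt 1F)) (trans (quadratic-at-vertex conic₀-coefficients 1F) (zeroˡ _))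
    conic₀-vanishes _ 2F = trans (eval-conics conic₀-coefficients (pt 2F)) (trans (quadratic-at-vertex conic₀-coefficients 2F) (zeroˡ _))
    conic₀-vanishes _ 3F = trans (eval-conic₀ (pt 3F)) (cross-·ˡ (R 3F) (R 4F))
    conic₀-vanishes _ 4F = trans (eval-conic₀ (pt 4F)) (cross-·ʳ (R 3F) (R 4F))
    conic₀-vanishes Δ≈0 5F = trans (eval-conic₀ (pt 5F)) Δ≈0

    -- at the point pt 0 + pt 1 of the line (0 1) only the term with side 0 and side 1 survives
    conic₀-nonzero : ¬ eval F conic₀ (pt 0F ⊕ pt 1F) ≈ 0#
    conic₀-nonzero ≈0 = *-nonzero w₁≉0 (*-nonzero (side-nonvanishing 0F) (side-nonvanishing 1F)) (trans (sym value) ≈0)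
      where
      a = eval F (side 0F) (pt 0F)
      b = eval F (side 1F) (pt 1F)
      at-sum : ∀ i → eval F (side i) (pt 0F ⊕ pt 1F) ≈ eval F (side i) (pt 0F) + eval F (side i) (pt 1F)
      at-sum 0F = trans (eval-lin _ _) (trans (·-⊕ _ _ _) (sym (+-cong (eval-lin _ _) (eval-lin _ _))))
      at-sum 1F = trans (eval-lin _ _) (trans (·-⊕ _ _ _) (sym (+-cong (eval-lin _ _) (eval-lin _ _))))
      at-sum 2F = trans (eval-lin _ _) (trans (·-⊕ _ _ _) (sym (+-cong (eval-lin _ _) (eval-lin _ _))))
      value : eval F conic₀ (pt 0F ⊕ pt 1F) ≈ proj₁ w * (a * b)
      value = trans (eval-conic₀ (pt 0F ⊕ pt 1F)) (trans (·-congˡ w (mixed-cong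
        (trans (at-sum 0F) (trans (+-congˡ (side-vanishes 1F 0F (λ ()))) (+-identityʳ a)))
        (trans (at-sum 1F) (trans (+-congʳ (side-vanishes 0F 1F (λ ()))) (+-identityˡ b)))
        (trans (at-sum 2F) (trans (+-cong (side-vanishes 0F 2F (λ ())) (side-vanishes 1F 2F (λ ()))) (+-identityʳ 0#)))))
        (solve 5 (λ w₁ w₂ w₃ a b → w₁ :* (a :* b) :+ w₂ :* (a :* con (0 , 0)) :+ w₃ :* (b :* con (0 , 0)) := w₁ :* (a :* b))
          refl (proj₁ w) (proj₁ (proj₂ w)) (proj₂ (proj₂ w)) a b))
      c₃ = eval F (side 2F) (pt 3F)
      c₄ = eval F (side 2F) (pt 4F)
      minor = det (pt 1F) (pt 2F) (pt 3F) * det (pt 2F) (pt 0F) (pt 4F) - det (pt 2F) (pt 0F) (pt 3F) * det (pt 1F) (pt 2F) (pt 4F)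
      w₁≈ : proj₁ w ≈ (c₃ * c₄) * minor
      w₁≈ = trans (+-cong (*-cong (*-congʳ (eval-line _ _ _)) (*-congʳ (eval-line _ _ _))) (-‿cong (*-cong (*-congʳ (eval-line _ _ _)) (*-congʳ (eval-line _ _ _)))))
        (solve 6 (λ a₃ b₃ a₄ b₄ c₃ c₄ → (a₃ :* c₃) :* (b₄ :* c₄) :- (b₃ :* c₃) :* (a₄ :* c₄) := (c₃ :* c₄) :* (a₃ :* b₄ :- b₃ :* a₄))
          refl _ _ _ _ c₃ c₄)
      w₁≉0 : ¬ proj₁ w ≈ 0#
      w₁≉0 w₁≈0 = *-nonzero (*-nonzero (line-nonvanishing (λ ()) (λ ()) (λ ())) (line-nonvanishing (λ ()) (λ ()) (λ ())))
                            (*-nonzero (det≉0 (λ ()) (λ ()) (λ ())) (det≉0 (λ ()) (λ ()) (λ ())))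
                            (trans (sym (trans w₁≈ (*-congˡ (det-exchange (pt 0F) (pt 1F) (pt 2F) (pt 3F) (pt 4F))))) w₁≈0)

    Δ≉0 : ¬ Δ ≈ 0#
    Δ≉0 Δ≈0 = ¬¬-dependent 6 rows dependent⇒⊥
      where
      quotient = generic 2
      fs = proj₁ quotient
      fs-independent = proj₁ (proj₂ (proj₂ quotient))
      fs-span : ∀ i → Span conic (fs i)
      fs-span i = Subspace.resp (Span-subspace conic) (Homogeneous⇒≈homComp (proj₁ (proj₂ quotient) i)) (quadric∈Span (homComp-ofDegree 2 (fs i)))
      -- coordinates, with respect to the conics, of conic₀ and of the six forms independent modulo I_A
      rows : Fin 7 → Fin 6 → Carrier
      rows 0F = conic₀-coefficients
      rows (fsuc i) = Span.coefficients (fs-span i)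
      multiple∈I : ∀ s → Points.InI F A (κ s *ₚ conic₀)
      multiple∈I s k = ofDegree-vanishesAt (OfDegree-* (κ-ofDegree s) (combination-ofDegree conic₀-coefficients conic conic-ofDegree)) (A k)
        (trans (eval-κ* s conic₀ (pt k)) (trans (*-congˡ (conic₀-vanishes Δ≈0 k)) (zeroʳ s)))
      dependent⇒⊥ : Dependent rows → ⊥
      dependent⇒⊥ (cs , nontrivial , relation) =
        conic₀-nonzero (x*y≈0⇒y≈0 c₀≉0 (trans (sym (eval-κ* c₀ conic₀ X)) (eval-cong X c₀q≈[])))
        where
        X = pt 0F ⊕ pt 1F
        c₀ = cs 0F
        cs′ : Fin 6 → Carrier
        cs′ i = cs (fsuc i)
        C = combination cs′ fs
        G≈[] : combination (λ j → sum (λ i → cs i * rows i j)) conic ≈ₚ []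
        G≈[] = combination-≈0 (λ j → sum (λ i → cs i * rows i j)) conic relation
        split : κ c₀ *ₚ conic₀ +ₚ C ≈ₚ []
        split = ℙ.trans (ℙ.sym (ℙ.trans (combination-Σ cs rows conic)
                  (ℙ.+-cong (ℙ.refl {κ c₀ *ₚ conic₀}) (combination-congʳ cs′ (λ i → ℙ.sym (Span.≈combination (fs-span i))))))) G≈[]
        C≈ : C ≈ₚ κ (- 1# * c₀) *ₚ conic₀
        C≈ = ℙ.trans (+-inverseʳ-unique (κ c₀ *ₚ conic₀) C split)
               (ℙ.trans (ℙ.sym (κ-scale (- 1#) (κ c₀ *ₚ conic₀))) (ℙ.trans (ℙ.sym (ℙ.*-assoc (κ (- 1#)) (κ c₀) conic₀)) (*ₚ-congʳ conic₀ (κ-κ (- 1#) c₀))))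
          where open import Algebra.Properties.Ring ℙ.ring using (+-inverseʳ-unique)
        cs′≈0 : ∀ i → cs′ i ≈ 0#
        cs′≈0 = fs-independent cs′ λ k → VanishesAt-resp (ℙ.trans (linComb≈combination cs′ fs) C≈) (A k) (multiple∈I (- 1# * c₀) k)
        c₀≉0 : ¬ c₀ ≈ 0#
        c₀≉0 c₀≈0 = nontrivial λ { 0F → c₀≈0 ; (fsuc i) → cs′≈0 i }
        c₀q≈[] : κ c₀ *ₚ conic₀ ≈ₚ []
        c₀q≈[] = ℙ.trans (ℙ.sym (ℙ.+-identityʳ (κ c₀ *ₚ conic₀))) (ℙ.trans (ℙ.+-cong (ℙ.refl {κ c₀ *ₚ conic₀}) (ℙ.sym (combination-≈0 cs′ fs cs′≈0))) split)

module Assembly {c ℓ : Level} (F : Field c ℓ) (A : Fin 6 → Point F)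
  (distinct : Points.Distinct F A) (general : Points.LinearlyGeneral F A) where

  open Field F
  open Polynomials F
  open Subspaces F
  open Configuration F A distinct general
  open Reduction F A distinct general
  open CubicDerivation F A distinct general
  open LowDegree F A distinct general

  prodLin∈Red : ∀ n vs → List.length vs ≡ 3 ℕ.+ n → Red n (prodLin vs)
  prodLin∈Red zero (u ∷ v ∷ w ∷ []) _ = cubic∈Red u v w
  prodLin∈Red (suc n) (v ∷ vs) len≡ = Red-step n v (prodLin∈Red n vs (ℕ.suc-injective len≡))

  form∈Red : ∀ n {p} → OfDegree (3 ℕ.+ n) p → Red n p
  form∈Red n = forms⊆ (Red-subspace n) (3 ℕ.+ n) (prodLin∈Red n)

  vanishing-form∈J : Points.Generic F A → ∀ t {p} → OfDegree t p → (∀ k → eval F p (pt k) ≈ 0#) → InJ p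
  vanishing-form∈J _       0 p-deg p-vanishes = ≈[]⇒InJ (form₀≈[] p-deg p-vanishes)
  vanishing-form∈J _       1 p-deg p-vanishes = ≈[]⇒InJ (form₁≈[] p-deg p-vanishes)
  vanishing-form∈J generic 2 p-deg p-vanishes = ≈[]⇒InJ (form₂≈[] (Δ≉0 generic) p-deg p-vanishes)
  vanishing-form∈J _ (suc (suc (suc n))) p-deg p-vanishes = vanishing-Red⇒InJ n (form∈Red n p-deg) p-vanishes

  I⊆J : Points.Generic F A → ∀ f → Points.InI F A f → InJ f
  I⊆J generic f f∈I = Subspace.resp InJ-subspace (≈ₚ-components f) (components∈J (maxDeg f))
    where
    components∈J : ∀ n → InJ (components n f)
    components∈J zero = vanishing-form∈J generic 0 (homComp-ofDegree 0 f) (λ k → f∈I k 0)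
    components∈J (suc n) = Subspace.+-closed InJ-subspace (components∈J n)
      (vanishing-form∈J generic (suc n) (homComp-ofDegree (suc n) f) (λ k → f∈I k (suc n)))

proposition5p3 : {c ℓ : Level} (F : Field c ℓ) → Infinite F → (A : Fin 6 → Point F) →
    Points.Distinct F A → Points.LinearlyGeneral F A → Points.Generic F A →
    Points.GeneratedByProdLin F A
proposition5p3 F _ A distinct general generic = J⇒GeneratedByProdLin (I⊆J generic)
  where
  open Reduction F A distinct general
  open Assembly F A distinct general
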